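{- Let $w \in \mathfrak{S}_n$ with $n>1$ and $\{w(1),\ldots,w(r)\}\ne\{1,\ldots,r\}$ for all $r<n$. If $w(1)\neq 1$, then there exists a rhombic tiling of $X(w)$ with a top-perimeter tile. If $w(n)\neq n$, then there exists a rhombic tiling of $X(w)$ with a bottom-perimeter tile.
   Context: Elnitsky's polygon $X(w)$: starting at the top vertex, label the sides $1,\ldots,n,w(n),\ldots,w(1)$ counterclockwise; sides $1,\dots,n$ form half of a convex $2n$-gon; the other sides are drawn so that sides are parallel and congruent iff equally labeled. A rhombic tiling is a tiling of $X(w)$ by rhombi whose edges are congruent and parallel to edges of $X(w)$. A top-perimeter (bottom-perimeter) tile is a tile containing both boundary edges of $X(w)$ incident to the top (bottom) vertex.
   Formalization: The plane containing X(w) and its rhombic tilings is replaced by ℚ², so the tiles and the covering, containment and disjoint-interior conditions concern points with rational coordinates. -}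

module Defs where

open import Data.Nat using (ℕ; zero; suc; _<_)
open import Data.Fin using (Fin; toℕ)
open import Data.Fin.Permutation using (Permutation′; _⟨$⟩ʳ_)
open import Data.Integer using (+_)
open import Data.Rational using (ℚ; _+_; _*_; -_; _≤_; _<_; 0ℚ; 1ℚ; _/_)
open import Data.List using (List; map; take; allFin; foldr; length; lookup)
open import Data.Product using (Σ; _×_; _,_; ∃; ∃-syntax)
open import Relation.Binary.PropositionalEquality using (_≡_)
open import Relation.Nullary using (¬_)

Point : Set
Point = ℚ × ℚ

_⊕_ : Point → Point → Point
(a , b) ⊕ (c , d) = (a + c , b + d)

_·_ : ℚ → Point → Point
t · (a , b) = (t * a , t * b)

origin : Point
origin = (0ℚ , 0ℚ)

ℕ→ℚ : ℕ → ℚ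
ℕ→ℚ k = (+ k) / 1

InI : ℚ → Set
InI t = 0ℚ ≤ t × t ≤ 1ℚ

InIo : ℚ → Set
InIo t = 0ℚ Data.Rational.< t × t Data.Rational.< 1ℚ

-- Edge vector of label i (labels 1..n are Fin n, i.e. 0..n-1).
-- v i = (i , -1): the directions v 0 , v 1 , ... , v (n-1) turn
-- counterclockwise, so the path v 0 , ... , v (n-1) from the top vertex is
-- half of a convex 2n-gon (an affine image of the usual picture).
vec : ∀ {n} → Fin n → Point
vec i = (ℕ→ℚ (toℕ i) , - 1ℚ)

sumQ : List ℚ → ℚ
sumQ = foldr _+_ 0ℚ

sumP : List Point → Point
sumP = foldr _⊕_ origin

-- x-coordinate after k steps along the left boundary (sides 1..n)
-- and along the right boundary (sides w(1),...,w(n)), from the top vertex.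
leftX : ∀ {n} → ℕ → ℚ
leftX {n} k = sumQ (map (λ i → ℕ→ℚ (toℕ i)) (take k (allFin n)))

rightX : ∀ {n} → Permutation′ n → ℕ → ℚ
rightX {n} w k = sumQ (map (λ i → ℕ→ℚ (toℕ (w ⟨$⟩ʳ i))) (take k (allFin n)))

-- Elnitsky's polygon X(w) as a closed region: top vertex at the origin,
-- left boundary sides 1..n, right boundary sides w(1)..w(n) (read from the
-- top); every side descends by exactly one unit, so X(w) is the set of points
-- lying between the two boundary paths at each height.
InX : ∀ {n} → Permutation′ n → Point → Set
InX {n} w (x , y) =
  ∃[ k ] ∃[ t ] (InI t × y ≡ - (ℕ→ℚ (toℕ {n} k) + t)
    × (leftX {n} (toℕ k) + t * ℕ→ℚ (toℕ k)) ≤ x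
    × x ≤ (rightX w (toℕ k) + t * ℕ→ℚ (toℕ (w ⟨$⟩ʳ k))))

record Tile (n : ℕ) : Set where
  constructor tile
  field
    base : Point
    a    : Fin n
    b    : Fin n
    a<b  : toℕ a Data.Nat.< toℕ b

InTile : ∀ {n} → Tile n → Point → Set
InTile T q = ∃[ s ] ∃[ t ] (InI s × InI t × q ≡ (Tile.base T ⊕ (s · vec (Tile.a T))) ⊕ (t · vec (Tile.b T)))

InTileInterior : ∀ {n} → Tile n → Point → Set
InTileInterior T q = ∃[ s ] ∃[ t ] (InIo s × InIo t × q ≡ (Tile.base T ⊕ (s · vec (Tile.a T))) ⊕ (t · vec (Tile.b T)))

IsRhombicTiling : ∀ {n} → Permutation′ n → List (Tile n) → Set
IsRhombicTiling w ts =
    (∀ (i : Fin (length ts)) q → InTile (lookup ts i) q → InX w q)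
  × (∀ q → InX w q → ∃[ i ] InTile (lookup ts i) q)
  × (∀ (i j : Fin (length ts)) q → ¬ (i ≡ j) →
        InTileInterior (lookup ts i) q → ¬ InTileInterior (lookup ts j) q)

SegIn : ∀ {n} → Point → Point → Tile n → Set
SegIn p v T = ∀ t → InI t → InTile T (p ⊕ (t · v))

bottom : (n : ℕ) → Point
bottom n = sumP (map vec (allFin n))

-_ₚ : Point → Point
-_ₚ (a , b) = (- a , - b)

TopPerimeter : ∀ {n} → Permutation′ (suc n) → Tile (suc n) → Set
TopPerimeter {n} w T = SegIn origin (vec {suc n} Fin.zero) T × SegIn origin (vec (w ⟨$⟩ʳ Fin.zero)) T
  where import Data.Fin as Fin

BottomPerimeter : ∀ {n} → Permutation′ (suc n) → Tile (suc n) → Set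
BottomPerimeter {n} w T =
    SegIn (bottom (suc n) ⊕ (-_ₚ (vec (Fin.fromℕ n)))) (vec (Fin.fromℕ n)) T
  × SegIn (bottom (suc n) ⊕ (-_ₚ (vec (w ⟨$⟩ʳ Fin.fromℕ n)))) (vec (w ⟨$⟩ʳ Fin.fromℕ n)) T
  where import Data.Fin as Fin

-- {w(1),...,w(r)} = {1,...,r}  (labels 0-based: positions/values < r).
PrefixStable : ∀ {n} → Permutation′ n → ℕ → Set
PrefixStable {n} w r = ∀ (j : Fin n) →
  ((∃[ i ] (toℕ i Data.Nat.< r × w ⟨$⟩ʳ i ≡ j)) → toℕ j Data.Nat.< r)
  × (toℕ j Data.Nat.< r → ∃[ i ] (toℕ i Data.Nat.< r × w ⟨$⟩ʳ i ≡ j))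

-- Applying the adjacent transposition s_i at a descent i of a permutation F moves the right
-- boundary of X(F) leftwards across exactly one rhombus: the one spanned by the sides F(i+1) < F(i)
-- at the right-boundary vertex of height i.  Once a reduced word has sorted w to the identity, the
-- polygon has collapsed onto its left boundary, so the rhombi removed along the way tile X(w).
-- The two boundaries of X(F) can only meet at heights r with {F(1),...,F(r)} = {1,...,r}, so for
-- irreducible w every point other than the top and bottom vertex lies in a rhombus.  A reduced word
-- that starts by bubbling 1 to the front (resp. n to the end) ends that phase with a swap whose
-- rhombus has sides 1 and w(1) at the top vertex (resp. w(n) and n at the bottom vertex).

module Submission where

open import Defs
open import Data.Nat using (ℕ; zero; suc; _<_; _≤_)
open import Data.Fin using (Fin; zero; fromℕ)
open import Data.Fin.Permutation using (Permutation′; _⟨$⟩ʳ_; _⟨$⟩ˡ_; inverseˡ; inverseʳ)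
open import Data.List using (List; []; _∷_; lookup; map; take; tabulate)
open import Data.Product using (Σ; _×_; _,_; proj₁; proj₂; uncurry; ∃-syntax)
open import Relation.Binary.PropositionalEquality using (_≡_; refl; sym; trans; cong; cong₂; subst; subst₂; module ≡-Reasoning)
open import Relation.Nullary using (¬_; Dec; yes; no)

import Data.Nat as ℕ
import Data.Nat.Properties as ℕ
open import Data.Nat.Coprimality using (1-coprimeTo) renaming (sym to coprime-sym)
import Data.Integer as ℤ
import Data.Integer.Properties as ℤ
open import Data.Rational as ℚ using (ℚ; 0ℚ; 1ℚ; mkℚ; _+_; _*_; -_; _-_)
import Data.Rational.Properties as ℚ
open import Data.Rational.Solver using (module +-*-Solver)
import Data.Fin as Fin
import Data.Fin.Properties as Fin
open import Data.List.Relation.Unary.Any as Any using (Any; here; there)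
open import Data.List.Relation.Unary.Any.Properties using (lookup-index)
open import Data.Empty using (⊥; ⊥-elim)
open import Data.Sum using (_⊎_; inj₁; inj₂)
open import Relation.Binary.Definitions using (tri<; tri≈; tri>)

open +-*-Solver

ℕ→ℚ≡mkℚ : ∀ k → ℕ→ℚ k ≡ mkℚ (ℤ.+ k) 0 (coprime-sym (1-coprimeTo k))
ℕ→ℚ≡mkℚ k = ℚ.normalize-coprime (coprime-sym (1-coprimeTo k))

ℕ→ℚ-+ : ∀ m n → ℕ→ℚ (m ℕ.+ n) ≡ ℕ→ℚ m + ℕ→ℚ n
ℕ→ℚ-+ m n rewrite ℕ→ℚ≡mkℚ m | ℕ→ℚ≡mkℚ n =
  cong (ℚ._/ 1) (sym (cong₂ ℤ._+_ (ℤ.*-identityʳ (ℤ.+ m)) (ℤ.*-identityʳ (ℤ.+ n))))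

ℕ→ℚ-suc : ∀ m → ℕ→ℚ (suc m) ≡ ℕ→ℚ m + 1ℚ
ℕ→ℚ-suc m = trans (cong ℕ→ℚ (ℕ.+-comm 1 m)) (ℕ→ℚ-+ m 1)

ℕ→ℚ-nonNeg : ∀ k → 0ℚ ℚ.≤ ℕ→ℚ k
ℕ→ℚ-nonNeg k rewrite ℕ→ℚ≡mkℚ k = ℚ.nonNegative⁻¹ _

≤-byDifference : ∀ {p q} e → q - p ≡ e → 0ℚ ℚ.≤ e → p ℚ.≤ q
≤-byDifference {p} {q} e q-p≡e 0≤e = subst₂ ℚ._≤_ (ℚ.+-identityˡ p) (solve 2 (λ p q → (q :- p) :+ p := q) refl p q)
  (ℚ.+-monoˡ-≤ p (subst (0ℚ ℚ.≤_) (sym q-p≡e) 0≤e))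

<-byDifference : ∀ {p q} e → q - p ≡ e → 0ℚ ℚ.< e → p ℚ.< q
<-byDifference {p} {q} e q-p≡e 0<e = subst₂ ℚ._<_ (ℚ.+-identityˡ p) (solve 2 (λ p q → (q :- p) :+ p := q) refl p q)
  (ℚ.+-monoˡ-< p (subst (0ℚ ℚ.<_) (sym q-p≡e) 0<e))

p≤q⇒0≤q-p : ∀ {p q} → p ℚ.≤ q → 0ℚ ℚ.≤ q - p
p≤q⇒0≤q-p {p} {q} p≤q = subst (ℚ._≤ q - p) (ℚ.+-inverseʳ p) (ℚ.+-monoˡ-≤ (- p) p≤q)

p<q⇒0<q-p : ∀ {p q} → p ℚ.< q → 0ℚ ℚ.< q - p
p<q⇒0<q-p {p} {q} p<q = subst (ℚ._< q - p) (ℚ.+-inverseʳ p) (ℚ.+-monoˡ-< (- p) p<q)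

*-nonNeg : ∀ {p q} → 0ℚ ℚ.≤ p → 0ℚ ℚ.≤ q → 0ℚ ℚ.≤ p * q
*-nonNeg {p} {q} 0≤p 0≤q = subst (ℚ._≤ p * q) (ℚ.*-zeroʳ p) (ℚ.*-monoˡ-≤-nonNeg p {{ℚ.nonNegative 0≤p}} 0≤q)

*-pos : ∀ {p q} → 0ℚ ℚ.< p → 0ℚ ℚ.< q → 0ℚ ℚ.< p * q
*-pos {p} {q} 0<p 0<q = subst (ℚ._< p * q) (ℚ.*-zeroʳ p) (ℚ.*-monoʳ-<-pos p {{ℚ.positive 0<p}} 0<q)

pos-invertible : ∀ {d} → 0ℚ ℚ.< d → Σ ℚ λ r → d * r ≡ 1ℚ × 0ℚ ℚ.≤ r
pos-invertible {d} 0<d = ℚ.1/ d , ℚ.*-inverseʳ d , ℚ.<⇒≤ (ℚ.positive⁻¹ (ℚ.1/ d) {{ℚ.1/pos⇒pos d}})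
  where instance
    _ = ℚ.positive 0<d
    _ = ℚ.pos⇒nonZero d

≤∧≢⇒< : ∀ {p q} → p ℚ.≤ q → ¬ p ≡ q → p ℚ.< q
≤∧≢⇒< {p} {q} p≤q p≢q with ℚ.<-cmp p q
... | tri< p<q _ _ = p<q
... | tri≈ _ p≡q _ = ⊥-elim (p≢q p≡q)
... | tri> _ _ q<p = ⊥-elim (ℚ.<-irrefl refl (ℚ.<-≤-trans q<p p≤q))

+-cancelʳ-≡ : ∀ {p q r} → p + r ≡ q + r → p ≡ q
+-cancelʳ-≡ {p} {q} {r} p+r≡q+r = begin
  p              ≡⟨ solve 2 (λ p r → p := (p :+ r) :- r) refl p r ⟩
  (p + r) - r    ≡⟨ cong (_- r) p+r≡q+r ⟩
  (q + r) - r    ≡⟨ solve 2 (λ q r → (q :+ r) :- r := q) refl q r ⟩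
  q              ∎
  where open ≡-Reasoning

p-q≡0⇒p≡q : ∀ {p q} → p - q ≡ 0ℚ → p ≡ q
p-q≡0⇒p≡q {p} {q} p-q≡0 =
  trans (solve 2 (λ p q → p := (p :- q) :+ q) refl p q) (trans (cong (_+ q) p-q≡0) (ℚ.+-identityˡ q))

nonNeg+nonNeg≤0 : ∀ {p q} → 0ℚ ℚ.≤ p → 0ℚ ℚ.≤ q → p + q ℚ.≤ 0ℚ → p ≡ 0ℚ × q ≡ 0ℚ
nonNeg+nonNeg≤0 {p} {q} 0≤p 0≤q p+q≤0 =
  ℚ.≤-antisym (ℚ.≤-trans (≤-byDifference q (solve 2 (λ p q → (p :+ q) :- p := q) refl p q) 0≤q) p+q≤0) 0≤p ,
  ℚ.≤-antisym (ℚ.≤-trans (≤-byDifference p (solve 2 (λ p q → (p :+ q) :- q := p) refl p q) 0≤p) p+q≤0) 0≤q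

pos*q≡0⇒q≡0 : ∀ {p q} → 0ℚ ℚ.< p → p * q ≡ 0ℚ → q ≡ 0ℚ
pos*q≡0⇒q≡0 {p} {q} 0<p pq≡0 = begin
  q            ≡⟨ sym (ℚ.*-identityˡ q) ⟩
  1ℚ * q       ≡⟨ cong (_* q) (sym (proj₁ (proj₂ (pos-invertible 0<p)))) ⟩
  (p * r) * q  ≡⟨ solve 3 (λ p r q → (p :* r) :* q := r :* (p :* q)) refl p r q ⟩
  r * (p * q)  ≡⟨ cong (r *_) pq≡0 ⟩
  r * 0ℚ       ≡⟨ ℚ.*-zeroʳ r ⟩
  0ℚ           ∎
  where
  open ≡-Reasoning
  r : ℚ
  r = proj₁ (pos-invertible 0<p)

ℕ→ℚ-mono-≤ : ∀ {m n} → m ≤ n → ℕ→ℚ m ℚ.≤ ℕ→ℚ n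
ℕ→ℚ-mono-≤ {m} {n} m≤n = ≤-byDifference (ℕ→ℚ (n ℕ.∸ m))
  (begin
    ℕ→ℚ n - ℕ→ℚ m                     ≡⟨ cong (λ k → ℕ→ℚ k - ℕ→ℚ m) (sym (ℕ.m+[n∸m]≡n m≤n)) ⟩
    ℕ→ℚ (m ℕ.+ (n ℕ.∸ m)) - ℕ→ℚ m     ≡⟨ cong (_- ℕ→ℚ m) (ℕ→ℚ-+ m (n ℕ.∸ m)) ⟩
    (ℕ→ℚ m + ℕ→ℚ (n ℕ.∸ m)) - ℕ→ℚ m  ≡⟨ solve 2 (λ a b → (a :+ b) :- a := b) refl (ℕ→ℚ m) _ ⟩
    ℕ→ℚ (n ℕ.∸ m)                     ∎)
  (ℕ→ℚ-nonNeg (n ℕ.∸ m))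
  where open ≡-Reasoning

ℕ→ℚ-mono-< : ∀ {m n} → m < n → ℕ→ℚ m ℚ.< ℕ→ℚ n
ℕ→ℚ-mono-< {m} {suc n} m<n = ℚ.<-≤-trans m<m+1 (ℕ→ℚ-mono-≤ m<n)
  where
  m<m+1 : ℕ→ℚ m ℚ.< ℕ→ℚ (suc m)
  m<m+1 = <-byDifference 1ℚ
    (trans (cong (_- ℕ→ℚ m) (ℕ→ℚ-suc m)) (solve 1 (λ a → (a :+ con 1ℚ) :- a := con 1ℚ) refl (ℕ→ℚ m)))
    (ℚ.positive⁻¹ 1ℚ)

0∈I : InI 0ℚ
0∈I = ℚ.≤-refl , ℚ.<⇒≤ (ℚ.positive⁻¹ 1ℚ)

1∈I : InI 1ℚ
1∈I = ℚ.<⇒≤ (ℚ.positive⁻¹ 1ℚ) , ℚ.≤-refl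

prefixSum : (ℕ → ℕ) → ℕ → ℚ
prefixSum F zero    = 0ℚ
prefixSum F (suc k) = ℕ→ℚ (F 0) + prefixSum (λ p → F (suc p)) k

prefixSum-cong : ∀ {F G} k → (∀ p → p < k → F p ≡ G p) → prefixSum F k ≡ prefixSum G k
prefixSum-cong zero    F≗G = refl
prefixSum-cong (suc k) F≗G =
  cong₂ (λ v s → ℕ→ℚ v + s) (F≗G 0 (ℕ.s≤s ℕ.z≤n)) (prefixSum-cong k (λ p p<k → F≗G (suc p) (ℕ.s≤s p<k)))

prefixSum-suc : ∀ F k → prefixSum F (suc k) ≡ prefixSum F k + ℕ→ℚ (F k)
prefixSum-suc F zero    = ℚ.+-comm (ℕ→ℚ (F 0)) 0ℚ
prefixSum-suc F (suc k) =
  trans (cong (ℕ→ℚ (F 0) +_) (prefixSum-suc (λ p → F (suc p)) k)) (sym (ℚ.+-assoc (ℕ→ℚ (F 0)) _ _))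

swap : ℕ → ℕ → ℕ
swap zero    zero          = 1
swap zero    (suc zero)    = 0
swap zero    (suc (suc p)) = suc (suc p)
swap (suc i) zero          = zero
swap (suc i) (suc p)       = suc (swap i p)

swap-i : ∀ i → swap i i ≡ suc i
swap-i zero    = refl
swap-i (suc i) = cong suc (swap-i i)

swap-suc-i : ∀ i → swap i (suc i) ≡ i
swap-suc-i zero    = refl
swap-suc-i (suc i) = cong suc (swap-suc-i i)

swap-other : ∀ i p → ¬ p ≡ i → ¬ p ≡ suc i → swap i p ≡ p
swap-other zero    zero          p≢i _     = ⊥-elim (p≢i refl)
swap-other zero    (suc zero)    _   p≢1+i = ⊥-elim (p≢1+i refl)
swap-other zero    (suc (suc p)) _   _     = refl
swap-other (suc i) zero          _   _     = refl
swap-other (suc i) (suc p)       p≢i p≢1+i =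
  cong suc (swap-other i p (λ e → p≢i (cong suc e)) (λ e → p≢1+i (cong suc e)))

swap-involutive : ∀ i p → swap i (swap i p) ≡ p
swap-involutive zero    zero          = refl
swap-involutive zero    (suc zero)    = refl
swap-involutive zero    (suc (suc p)) = refl
swap-involutive (suc i) zero          = refl
swap-involutive (suc i) (suc p)       = cong suc (swap-involutive i p)

swap-< : ∀ i p r → ¬ r ≡ suc i → p < r → swap i p < r
swap-< zero    zero          (suc zero)    r≢1+i _   = ⊥-elim (r≢1+i refl)
swap-< zero    zero          (suc (suc r)) _     _   = ℕ.s≤s (ℕ.s≤s ℕ.z≤n)
swap-< zero    (suc zero)    r             _     p<r = ℕ.<-trans (ℕ.s≤s ℕ.z≤n) p<r
swap-< zero    (suc (suc p)) r             _     p<r = p<r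
swap-< (suc i) zero          r             _     p<r = p<r
swap-< (suc i) (suc p)       (suc r) r≢1+i (ℕ.s≤s p<r) =
  ℕ.s≤s (swap-< i p r (λ e → r≢1+i (cong suc e)) p<r)

prefixSum-swap : ∀ i k F → ¬ k ≡ suc i → prefixSum (λ p → F (swap i p)) k ≡ prefixSum F k
prefixSum-swap i       zero          F _ = refl
prefixSum-swap zero    (suc zero)    F k≢1+i = ⊥-elim (k≢1+i refl)
prefixSum-swap zero    (suc (suc k)) F _ =
  solve 3 (λ a b s → b :+ (a :+ s) := a :+ (b :+ s)) refl
    (ℕ→ℚ (F 0)) (ℕ→ℚ (F 1)) (prefixSum (λ p → F (suc (suc p))) k)
prefixSum-swap (suc i) (suc k)       F k≢1+i =
  cong (ℕ→ℚ (F 0) +_) (prefixSum-swap i k (λ p → F (suc p)) (λ e → k≢1+i (cong suc e)))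

data Position (k i : ℕ) : Set where
  below  : k < i → Position k i
  at     : k ≡ i → Position k i
  at-suc : k ≡ suc i → Position k i
  above  : suc (suc i) ≤ k → Position k i

position : ∀ k i → Position k i
position zero          zero    = at refl
position zero          (suc i) = below (ℕ.s≤s ℕ.z≤n)
position (suc zero)    zero    = at-suc refl
position (suc (suc k)) zero    = above (ℕ.s≤s (ℕ.s≤s ℕ.z≤n))
position (suc k)       (suc i) with position k i
... | below k<i    = below (ℕ.s≤s k<i)
... | at k≡i       = at (cong suc k≡i)
... | at-suc k≡1+i = at-suc (cong suc k≡1+i)
... | above 2+i≤k  = above (ℕ.s≤s 2+i≤k)

StablePrefix : (ℕ → ℕ) → ℕ → Set
StablePrefix F r = ∀ v → ((Σ ℕ λ p → p < r × F p ≡ v) → v < r) × (v < r → Σ ℕ λ p → p < r × F p ≡ v)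

StablePrefix-swap : ∀ F i r → ¬ r ≡ suc i → StablePrefix (λ p → F (swap i p)) r → StablePrefix F r
StablePrefix-swap F i r r≢1+i stable v = image⊆ , ⊆image
  where
  image⊆ : (Σ ℕ λ p → p < r × F p ≡ v) → v < r
  image⊆ (p , p<r , Fp≡v) =
    proj₁ (stable v) (swap i p , swap-< i p r r≢1+i p<r , trans (cong F (swap-involutive i p)) Fp≡v)
  ⊆image : v < r → Σ ℕ λ p → p < r × F p ≡ v
  ⊆image v<r with proj₂ (stable v) v<r
  ... | p , p<r , Gp≡v = swap i p , swap-< i p r r≢1+i p<r , Gp≡v

Fixes : (ℕ → ℕ) → ℕ → Set
Fixes F m = ∀ p → p < m → F p ≡ p

StablePrefix-identity : ∀ {F r} → Fixes F r → StablePrefix F r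
StablePrefix-identity {F} {r} fixes v =
  (λ { (p , p<r , Fp≡v) → subst (_< r) (trans (sym (fixes p p<r)) Fp≡v) p<r }) ,
  (λ v<r → v , v<r , fixes v v<r)

tileFarCorner : ∀ {N} → Tile N → Point
tileFarCorner T = (Tile.base T ⊕ vec (Tile.a T)) ⊕ vec (Tile.b T)

-- Permutations are handled as functions on ℕ (junk value 0 from M on), so that adjacent
-- transpositions act by composition with swap.
extend : ∀ {M} → (Fin M → ℕ) → ℕ → ℕ
extend {zero}  f _       = 0
extend {suc M} f zero    = f Fin.zero
extend {suc M} f (suc p) = extend (λ i → f (Fin.suc i)) p

extend-toℕ : ∀ {M} (f : Fin M → ℕ) i → extend f (Fin.toℕ i) ≡ f i
extend-toℕ {suc M} f Fin.zero    = refl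
extend-toℕ {suc M} f (Fin.suc i) = extend-toℕ (λ i → f (Fin.suc i)) i

extend-fromℕ< : ∀ {M} (f : Fin M → ℕ) {p} (p<M : p < M) → extend f p ≡ f (Fin.fromℕ< p<M)
extend-fromℕ< f {p} p<M = trans (cong (extend f) (sym (Fin.toℕ-fromℕ< p<M))) (extend-toℕ f (Fin.fromℕ< p<M))

extend-toℕ-identity : ∀ {M p} → p < M → extend {M} Fin.toℕ p ≡ p
extend-toℕ-identity p<M = trans (extend-fromℕ< Fin.toℕ p<M) (Fin.toℕ-fromℕ< p<M)

sumQ-take≡prefixSum : ∀ {A : Set} M (u : Fin M → A) (g : A → ℕ) k →
                      sumQ (map (λ x → ℕ→ℚ (g x)) (take k (tabulate u))) ≡ prefixSum (extend (λ i → g (u i))) k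
sumQ-take≡prefixSum zero    u g zero    = refl
sumQ-take≡prefixSum zero    u g (suc k) = sym (prefixSum-zero (suc k))
  where
  prefixSum-zero : ∀ k → prefixSum (λ _ → 0) k ≡ 0ℚ
  prefixSum-zero zero    = refl
  prefixSum-zero (suc k) = trans (cong (0ℚ +_) (prefixSum-zero k)) (ℚ.+-identityˡ 0ℚ)
sumQ-take≡prefixSum (suc M) u g zero    = refl
sumQ-take≡prefixSum (suc M) u g (suc k) = cong (ℕ→ℚ (g (u Fin.zero)) +_) (sumQ-take≡prefixSum M (λ i → u (Fin.suc i)) g k)

sumP-edges : ∀ {N′} M (u : Fin M → Fin N′) →
             sumP (map vec (tabulate u)) ≡ (prefixSum (extend (λ i → Fin.toℕ (u i))) M , - ℕ→ℚ M)
sumP-edges zero    u = refl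
sumP-edges (suc M) u = trans (cong (vec (u Fin.zero) ⊕_) (sumP-edges M (λ i → u (Fin.suc i))))
  (cong₂ _,_ refl (trans (solve 1 (λ c → con (- 1ℚ) :+ :- c := :- (c :+ con 1ℚ)) refl (ℕ→ℚ M))
                         (cong -_ (sym (ℕ→ℚ-suc M)))))

tile-sides-at-base : ∀ {N} (T : Tile N) → SegIn (Tile.base T) (vec (Tile.a T)) T × SegIn (Tile.base T) (vec (Tile.b T)) T
tile-sides-at-base (tile (x , y) a b _) =
  (λ t It → t , 0ℚ , It , 0∈I , cong₂ _,_
     (solve 4 (λ x t A B → x :+ t :* A := (x :+ t :* A) :+ con 0ℚ :* B) refl x t A B)
     (solve 3 (λ y t m → y :+ t :* m := (y :+ t :* m) :+ con 0ℚ :* m) refl y t (- 1ℚ))) ,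
  (λ t It → 0ℚ , t , 0∈I , It , cong₂ _,_
     (solve 4 (λ x t A B → x :+ t :* B := (x :+ con 0ℚ :* A) :+ t :* B) refl x t A B)
     (solve 3 (λ y t m → y :+ t :* m := (y :+ con 0ℚ :* m) :+ t :* m) refl y t (- 1ℚ)))
  where
  A B : ℚ
  A = ℕ→ℚ (Fin.toℕ a)
  B = ℕ→ℚ (Fin.toℕ b)

tile-sides-at-farCorner : ∀ {N} (T : Tile N) →
  SegIn (tileFarCorner T ⊕ (-_ₚ (vec (Tile.a T)))) (vec (Tile.a T)) T ×
  SegIn (tileFarCorner T ⊕ (-_ₚ (vec (Tile.b T)))) (vec (Tile.b T)) T
tile-sides-at-farCorner (tile (x , y) a b _) =
  (λ t It → t , 1ℚ , It , 1∈I , cong₂ _,_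
     (solve 4 (λ x t A B → (((x :+ A) :+ B) :+ :- A) :+ t :* A := (x :+ t :* A) :+ con 1ℚ :* B) refl x t A B)
     (solve 3 (λ y t m → (((y :+ m) :+ m) :+ :- m) :+ t :* m := (y :+ t :* m) :+ con 1ℚ :* m) refl y t (- 1ℚ))) ,
  (λ t It → 1ℚ , t , 1∈I , It , cong₂ _,_
     (solve 4 (λ x t A B → (((x :+ A) :+ B) :+ :- B) :+ t :* B := (x :+ con 1ℚ :* A) :+ t :* B) refl x t A B)
     (solve 3 (λ y t m → (((y :+ m) :+ m) :+ :- m) :+ t :* m := (y :+ con 1ℚ :* m) :+ t :* m) refl y t (- 1ℚ)))
  where
  A B : ℚ
  A = ℕ→ℚ (Fin.toℕ a)
  B = ℕ→ℚ (Fin.toℕ b)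

module Region (N : ℕ) where

  right : (ℕ → ℕ) → ℕ → ℚ → ℚ
  right F k t = prefixSum F k + t * ℕ→ℚ (F k)

  left : ℕ → ℚ → ℚ
  left = right (λ p → p)

  InRegionAt : (ℕ → ℕ) → Point → ℕ → ℚ → Set
  InRegionAt F (x , y) k t = InI t × y ≡ - (ℕ→ℚ k + t) × left k t ℚ.≤ x × x ℚ.≤ right F k t

  InRegion : (ℕ → ℕ) → Point → Set
  InRegion F q = Σ ℕ λ k → k < N × Σ ℚ λ t → InRegionAt F q k t

  InRegionWide : (ℕ → ℕ) → Point → Set
  InRegionWide F q = Σ ℕ λ k → k < N × Σ ℚ λ t → InRegionAt F q k t × left k t ℚ.< right F k t

  BoundariesOrdered : (ℕ → ℕ) → Set
  BoundariesOrdered F = ∀ k t → k < N → InI t → left k t ℚ.≤ right F k t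

  edge : ℕ → Point
  edge A = (ℕ→ℚ A , - 1ℚ)

  -- InTile T unfolds to Rhombus InI (Tile.base T) (toℕ (Tile.a T)) (toℕ (Tile.b T)).
  Rhombus : (ℚ → Set) → Point → ℕ → ℕ → Point → Set
  Rhombus I P A B q = Σ ℚ λ s → Σ ℚ λ u → I s × I u × q ≡ (P ⊕ (s · edge A)) ⊕ (u · edge B)

  vertex : (ℕ → ℕ) → ℕ → Point
  vertex F i = (prefixSum F i , - ℕ→ℚ i)

  -- The right boundaries of X(G) and X(F) agree outside the strips
  -- of heights i and i+1, and between them they enclose exactly the rhombus with sides a < b at the
  -- right-boundary vertex of height i.
  module Descent (F : ℕ → ℕ) (i : ℕ) (1+i<N : suc i < N) (descent : F (suc i) < F i) where

    G : ℕ → ℕ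
    G p = F (swap i p)

    a b : ℕ
    a = F (suc i)
    b = F i

    S A B D : ℚ
    S = prefixSum F i
    A = ℕ→ℚ a
    B = ℕ→ℚ b
    D = B - A

    0<D : 0ℚ ℚ.< D
    0<D = p<q⇒0<q-p (ℕ→ℚ-mono-< descent)

    0≤D : 0ℚ ℚ.≤ D
    0≤D = ℚ.<⇒≤ 0<D

    i≢1+i : ¬ i ≡ suc i
    i≢1+i ()

    right-G-i : ∀ t → right G i t ≡ S + t * A
    right-G-i t = cong₂ (λ s v → s + t * ℕ→ℚ (F v)) (prefixSum-swap i i F i≢1+i) (swap-i i)

    prefixSum-G-suc-i : prefixSum G (suc i) ≡ S + A
    prefixSum-G-suc-i = trans (prefixSum-suc G i)
      (cong₂ (λ s v → s + ℕ→ℚ (F v)) (prefixSum-swap i i F i≢1+i) (swap-i i))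

    right-G-suc-i : ∀ t → right G (suc i) t ≡ (S + A) + t * B
    right-G-suc-i t = cong₂ (λ s v → s + t * ℕ→ℚ (F v)) prefixSum-G-suc-i (swap-suc-i i)

    right-F-suc-i : ∀ t → right F (suc i) t ≡ (S + B) + t * A
    right-F-suc-i t = cong (_+ t * A) (prefixSum-suc F i)

    right-G-other : ∀ k t → ¬ k ≡ i → ¬ k ≡ suc i → right G k t ≡ right F k t
    right-G-other k t k≢i k≢1+i =
      cong₂ (λ s v → s + t * ℕ→ℚ (F v)) (prefixSum-swap i k F k≢1+i) (swap-other i k k≢i k≢1+i)

    below⇒outside : ∀ {k} → k < i → ¬ k ≡ i × ¬ k ≡ suc i
    below⇒outside k<i = (λ { refl → ℕ.<-irrefl refl k<i }) , (λ { refl → ℕ.<-asym k<i (ℕ.n<1+n i) })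

    above⇒outside : ∀ {k} → suc (suc i) ≤ k → ¬ k ≡ i × ¬ k ≡ suc i
    above⇒outside 2+i≤k =
      (λ { refl → ℕ.<-irrefl refl (ℕ.<-trans (ℕ.n<1+n i) 2+i≤k) }) , (λ { refl → ℕ.<-irrefl refl 2+i≤k })

    right-G≤right-F : ∀ k t → InI t → right G k t ℚ.≤ right F k t
    right-G≤right-F k t (0≤t , t≤1) = by-position (position k i)
      where
      by-position : Position k i → right G k t ℚ.≤ right F k t
      by-position (below k<i)   = ℚ.≤-reflexive (uncurry (right-G-other k t) (below⇒outside k<i))
      by-position (above 2+i≤k) = ℚ.≤-reflexive (uncurry (right-G-other k t) (above⇒outside 2+i≤k))
      by-position (at refl)     = subst (ℚ._≤ right F i t) (sym (right-G-i t))
        (≤-byDifference (t * D) (solve 4 (λ S t A B → (S :+ t :* B) :- (S :+ t :* A) := t :* (B :- A)) refl S t A B)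
          (*-nonNeg 0≤t 0≤D))
      by-position (at-suc refl) = subst₂ ℚ._≤_ (sym (right-G-suc-i t)) (sym (right-F-suc-i t))
        (≤-byDifference ((1ℚ - t) * D)
          (solve 4 (λ S t A B → ((S :+ B) :+ t :* A) :- ((S :+ A) :+ t :* B) := (con 1ℚ :- t) :* (B :- A)) refl S t A B)
          (*-nonNeg (p≤q⇒0≤q-p t≤1) 0≤D))

    region-G⊆region-F : ∀ q → InRegion G q → InRegion F q
    region-G⊆region-F q (k , k<N , t , It , y≡ , left≤x , x≤right) =
      k , k<N , t , It , y≡ , left≤x , ℚ.≤-trans x≤right (right-G≤right-F k t It)

    rhombusX : ℚ → ℚ → ℚ
    rhombusX s u = (S + s * A) + u * B

    gap-G-i : ∀ s u → rhombusX s u - (S + (s + u) * A) ≡ u * D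
    gap-G-i = solve 5 (λ S A B s u → ((S :+ s :* A) :+ u :* B) :- (S :+ (s :+ u) :* A) := u :* (B :- A)) refl S A B

    gap-F-i : ∀ s u → (S + (s + u) * B) - rhombusX s u ≡ s * D
    gap-F-i = solve 5 (λ S A B s u → (S :+ (s :+ u) :* B) :- ((S :+ s :* A) :+ u :* B) := s :* (B :- A)) refl S A B

    gap-G-suc-i : ∀ s u → rhombusX s u - ((S + A) + ((s + u) - 1ℚ) * B) ≡ (1ℚ - s) * D
    gap-G-suc-i = solve 5 (λ S A B s u →
      ((S :+ s :* A) :+ u :* B) :- ((S :+ A) :+ ((s :+ u) :- con 1ℚ) :* B) := (con 1ℚ :- s) :* (B :- A)) refl S A B

    gap-F-suc-i : ∀ s u → ((S + B) + ((s + u) - 1ℚ) * A) - rhombusX s u ≡ (1ℚ - u) * D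
    gap-F-suc-i = solve 5 (λ S A B s u →
      ((S :+ B) :+ ((s :+ u) :- con 1ℚ) :* A) :- ((S :+ s :* A) :+ u :* B) := (con 1ℚ :- u) :* (B :- A)) refl S A B

    rhombus-y : ∀ s u → (- ℕ→ℚ i + s * (- 1ℚ)) + u * (- 1ℚ) ≡ - (ℕ→ℚ i + (s + u))
    rhombus-y = solve 3 (λ c s u → (:- c :+ s :* con (- 1ℚ)) :+ u :* con (- 1ℚ) := :- (c :+ (s :+ u))) refl (ℕ→ℚ i)

    i<N : i < N
    i<N = ℕ.<-trans (ℕ.n<1+n i) 1+i<N

    rhombus⊆region-lower : BoundariesOrdered G → ∀ s u → InI s → InI u → s + u ℚ.≤ 1ℚ →
                           InRegion F (rhombusX s u , - (ℕ→ℚ i + (s + u)))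
    rhombus⊆region-lower ordered-G s u (0≤s , _) (0≤u , _) s+u≤1 =
      i , i<N , s + u , Ih , refl , left≤x , x≤right
      where
      Ih : InI (s + u)
      Ih = ℚ.+-mono-≤ 0≤s 0≤u , s+u≤1
      left≤x : left i (s + u) ℚ.≤ rhombusX s u
      left≤x = ℚ.≤-trans (ordered-G i (s + u) i<N Ih)
        (subst (ℚ._≤ rhombusX s u) (sym (right-G-i (s + u))) (≤-byDifference (u * D) (gap-G-i s u) (*-nonNeg 0≤u 0≤D)))
      x≤right : rhombusX s u ℚ.≤ right F i (s + u)
      x≤right = ≤-byDifference (s * D) (gap-F-i s u) (*-nonNeg 0≤s 0≤D)

    rhombus⊆region-upper : BoundariesOrdered G → ∀ s u → InI s → InI u → 1ℚ ℚ.< s + u →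
                           InRegion F (rhombusX s u , - (ℕ→ℚ i + (s + u)))
    rhombus⊆region-upper ordered-G s u (_ , s≤1) (_ , u≤1) 1<s+u =
      suc i , 1+i<N , h , Ih , y≡ , left≤x , x≤right
      where
      h : ℚ
      h = (s + u) - 1ℚ
      Ih : InI h
      Ih = ℚ.<⇒≤ (p<q⇒0<q-p 1<s+u) ,
           ≤-byDifference ((1ℚ - s) + (1ℚ - u))
             (solve 2 (λ s u → con 1ℚ :- ((s :+ u) :- con 1ℚ) := (con 1ℚ :- s) :+ (con 1ℚ :- u)) refl s u)
             (ℚ.+-mono-≤ (p≤q⇒0≤q-p s≤1) (p≤q⇒0≤q-p u≤1))
      y≡ : - (ℕ→ℚ i + (s + u)) ≡ - (ℕ→ℚ (suc i) + h)
      y≡ = trans (solve 3 (λ c s u → :- (c :+ (s :+ u)) := :- ((c :+ con 1ℚ) :+ ((s :+ u) :- con 1ℚ))) refl (ℕ→ℚ i) s u)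
             (cong (λ c → - (c + h)) (sym (ℕ→ℚ-suc i)))
      left≤x : left (suc i) h ℚ.≤ rhombusX s u
      left≤x = ℚ.≤-trans (ordered-G (suc i) h 1+i<N Ih)
        (subst (ℚ._≤ rhombusX s u) (sym (right-G-suc-i h))
          (≤-byDifference ((1ℚ - s) * D) (gap-G-suc-i s u) (*-nonNeg (p≤q⇒0≤q-p s≤1) 0≤D)))
      x≤right : rhombusX s u ℚ.≤ right F (suc i) h
      x≤right = subst (rhombusX s u ℚ.≤_) (sym (right-F-suc-i h))
        (≤-byDifference ((1ℚ - u) * D) (gap-F-suc-i s u) (*-nonNeg (p≤q⇒0≤q-p u≤1) 0≤D))

    rhombus⊆region : BoundariesOrdered G → ∀ q → Rhombus InI (vertex F i) a b q → InRegion F q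
    rhombus⊆region ordered-G q (s , u , Is , Iu , refl) =
      subst (InRegion F) (cong (rhombusX s u ,_) (sym (rhombus-y s u))) (by-height ((s + u) ℚ.≤? 1ℚ))
      where
      by-height : Dec (s + u ℚ.≤ 1ℚ) → InRegion F (rhombusX s u , - (ℕ→ℚ i + (s + u)))
      by-height (yes s+u≤1) = rhombus⊆region-lower ordered-G s u Is Iu s+u≤1
      by-height (no s+u≰1)  = rhombus⊆region-upper ordered-G s u Is Iu (ℚ.≰⇒> s+u≰1)

    rhombus°-separated : ∀ s u k τ → InIo s → InIo u → InI τ → ℕ→ℚ k + τ ≡ ℕ→ℚ i + (s + u) →
                         rhombusX s u ℚ.≤ right G k τ → Position k i → ⊥
    rhombus°-separated s u k τ (0<s , s<1) (0<u , u<1) (0≤τ , τ≤1) heights x≤right (below k<i) =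
      ℚ.<-irrefl heights (ℚ.≤-<-trans k+τ≤i i<i+s+u)
      where
      i<i+s+u : ℕ→ℚ i ℚ.< ℕ→ℚ i + (s + u)
      i<i+s+u = <-byDifference (s + u) (solve 2 (λ c h → (c :+ h) :- c := h) refl (ℕ→ℚ i) (s + u))
        (ℚ.+-mono-<-≤ 0<s (ℚ.<⇒≤ 0<u))
      k+τ≤i : ℕ→ℚ k + τ ℚ.≤ ℕ→ℚ i
      k+τ≤i = ℚ.≤-trans (ℚ.+-monoʳ-≤ (ℕ→ℚ k) τ≤1)
        (subst (ℚ._≤ ℕ→ℚ i) (ℕ→ℚ-suc k) (ℕ→ℚ-mono-≤ k<i))
    rhombus°-separated s u k τ (0<s , s<1) (0<u , u<1) (0≤τ , τ≤1) heights x≤right (above 2+i≤k) =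
      ℚ.<-irrefl (sym heights) (ℚ.<-≤-trans i+s+u<2+i (ℚ.≤-trans (ℕ→ℚ-mono-≤ 2+i≤k) k≤k+τ))
      where
      i+s+u<2+i : ℕ→ℚ i + (s + u) ℚ.< ℕ→ℚ (suc (suc i))
      i+s+u<2+i = subst (ℕ→ℚ i + (s + u) ℚ.<_)
        (sym (trans (ℕ→ℚ-suc (suc i)) (trans (cong (_+ 1ℚ) (ℕ→ℚ-suc i))
          (solve 1 (λ c → (c :+ con 1ℚ) :+ con 1ℚ := c :+ (con 1ℚ :+ con 1ℚ)) refl (ℕ→ℚ i)))))
        (ℚ.+-monoʳ-< (ℕ→ℚ i) (ℚ.+-mono-< s<1 u<1))
      k≤k+τ : ℕ→ℚ k ℚ.≤ ℕ→ℚ k + τ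
      k≤k+τ = ≤-byDifference τ (solve 2 (λ k τ → (k :+ τ) :- k := τ) refl (ℕ→ℚ k) τ) 0≤τ
    rhombus°-separated s u k τ (0<s , s<1) (0<u , u<1) (0≤τ , τ≤1) heights x≤right (at refl) =
      ℚ.<-irrefl refl (ℚ.<-≤-trans right<x (subst (rhombusX s u ℚ.≤_) (right-G-i τ) x≤right))
      where
      τ≡ : τ ≡ s + u
      τ≡ = trans (solve 2 (λ c τ → τ := (c :+ τ) :- c) refl (ℕ→ℚ i) τ)
             (trans (cong (_- ℕ→ℚ i) heights) (solve 3 (λ c s u → (c :+ (s :+ u)) :- c := s :+ u) refl (ℕ→ℚ i) s u))
      right<x : S + τ * A ℚ.< rhombusX s u
      right<x = <-byDifference (u * D)
        (subst (λ h → rhombusX s u - (S + h * A) ≡ u * D) (sym τ≡) (gap-G-i s u)) (*-pos 0<u 0<D)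
    rhombus°-separated s u k τ (0<s , s<1) (0<u , u<1) (0≤τ , τ≤1) heights x≤right (at-suc refl) =
      ℚ.<-irrefl refl (ℚ.<-≤-trans right<x (subst (rhombusX s u ℚ.≤_) (right-G-suc-i τ) x≤right))
      where
      τ≡ : τ ≡ (s + u) - 1ℚ
      τ≡ = trans (solve 2 (λ c τ → τ := (c :+ τ) :- c) refl (ℕ→ℚ (suc i)) τ)
             (trans (cong₂ _-_ heights (ℕ→ℚ-suc i))
               (solve 3 (λ c s u → (c :+ (s :+ u)) :- (c :+ con 1ℚ) := (s :+ u) :- con 1ℚ) refl (ℕ→ℚ i) s u))
      right<x : (S + A) + τ * B ℚ.< rhombusX s u
      right<x = <-byDifference ((1ℚ - s) * D)
        (subst (λ h → rhombusX s u - ((S + A) + h * B) ≡ (1ℚ - s) * D) (sym τ≡) (gap-G-suc-i s u))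
        (*-pos (p<q⇒0<q-p s<1) 0<D)

    rhombus°∩region-G≡∅ : ∀ q → Rhombus InIo (vertex F i) a b q → ¬ InRegion G q
    rhombus°∩region-G≡∅ q (s , u , Is , Iu , refl) (k , _ , τ , Iτ , y≡ , _ , x≤right) =
      rhombus°-separated s u k τ Is Iu Iτ (ℚ.neg-injective (trans (sym y≡) (rhombus-y s u))) x≤right (position k i)

    D⁻¹ : ℚ
    D⁻¹ = proj₁ (pos-invertible 0<D)

    D*D⁻¹≡1 : D * D⁻¹ ≡ 1ℚ
    D*D⁻¹≡1 = proj₁ (proj₂ (pos-invertible 0<D))

    ÷D-nonNeg : ∀ {v} → 0ℚ ℚ.≤ v → 0ℚ ℚ.≤ v * D⁻¹
    ÷D-nonNeg 0≤v = *-nonNeg 0≤v (proj₂ (proj₂ (pos-invertible 0<D)))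

    ÷D-cancel : ∀ c → (c * D) * D⁻¹ ≡ c
    ÷D-cancel c = trans (ℚ.*-assoc c D D⁻¹) (trans (cong (c *_) D*D⁻¹≡1) (ℚ.*-identityʳ c))

    ÷D-≤ : ∀ {v c} → v ℚ.≤ c * D → v * D⁻¹ ℚ.≤ c
    ÷D-≤ {v} {c} v≤cD = subst (v * D⁻¹ ℚ.≤_) (÷D-cancel c)
      (ℚ.*-monoʳ-≤-nonNeg D⁻¹ {{ℚ.nonNegative (proj₂ (proj₂ (pos-invertible 0<D)))}} v≤cD)

    ÷D-inverse : ∀ v → (v * D⁻¹) * D ≡ v
    ÷D-inverse v =
      trans (ℚ.*-assoc v D⁻¹ D) (trans (cong (v *_) (trans (ℚ.*-comm D⁻¹ D) D*D⁻¹≡1)) (ℚ.*-identityʳ v))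

    rhombus-at : ∀ {x y} s u → InI s → InI u → x ≡ rhombusX s u → y ≡ - (ℕ→ℚ i + (s + u)) →
                 Rhombus InI (vertex F i) a b (x , y)
    rhombus-at s u Is Iu refl y≡ = s , u , Is , Iu , cong₂ _,_ refl (trans y≡ (sym (rhombus-y s u)))

    gap⊆rhombus-at-i : ∀ x y t → InI t → y ≡ - (ℕ→ℚ i + t) → S + t * A ℚ.≤ x → x ℚ.≤ S + t * B →
                       Rhombus InI (vertex F i) a b (x , y)
    gap⊆rhombus-at-i x y t (0≤t , t≤1) y≡ G≤x x≤F =
      rhombus-at (t - u) u (0≤t-u , t-u≤1) (0≤u , u≤1) x≡
        (trans y≡ (cong (λ h → - (ℕ→ℚ i + h)) (solve 2 (λ t u → t := (t :- u) :+ u) refl t u)))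
      where
      v : ℚ
      v = x - (S + t * A)
      v≤tD : v ℚ.≤ t * D
      v≤tD = ≤-byDifference ((S + t * B) - x)
        (solve 5 (λ x S t A B → t :* (B :- A) :- (x :- (S :+ t :* A)) := (S :+ t :* B) :- x) refl x S t A B)
        (p≤q⇒0≤q-p x≤F)
      u : ℚ
      u = v * D⁻¹
      0≤u : 0ℚ ℚ.≤ u
      0≤u = ÷D-nonNeg (p≤q⇒0≤q-p G≤x)
      u≤t : u ℚ.≤ t
      u≤t = ÷D-≤ v≤tD
      u≤1 : u ℚ.≤ 1ℚ
      u≤1 = ℚ.≤-trans u≤t t≤1
      0≤t-u : 0ℚ ℚ.≤ t - u
      0≤t-u = p≤q⇒0≤q-p u≤t
      t-u≤1 : t - u ℚ.≤ 1ℚ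
      t-u≤1 = ℚ.≤-trans (≤-byDifference u (solve 2 (λ t u → t :- (t :- u) := u) refl t u) 0≤u) t≤1
      x≡ : x ≡ rhombusX (t - u) u
      x≡ = begin
        x                    ≡⟨ solve 2 (λ x c → x := c :+ (x :- c)) refl x (S + t * A) ⟩
        (S + t * A) + v      ≡⟨ cong ((S + t * A) +_) (sym (÷D-inverse v)) ⟩
        (S + t * A) + u * D  ≡⟨ solve 5 (λ S t A B u → (S :+ t :* A) :+ u :* (B :- A) := (S :+ (t :- u) :* A) :+ u :* B)
                                          refl S t A B u ⟩
        rhombusX (t - u) u   ∎
        where open ≡-Reasoning

    gap⊆rhombus-at-suc-i : ∀ x y t → InI t → y ≡ - (ℕ→ℚ (suc i) + t) →
                           (S + A) + t * B ℚ.≤ x → x ℚ.≤ (S + B) + t * A → Rhombus InI (vertex F i) a b (x , y)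
    gap⊆rhombus-at-suc-i x y t (0≤t , t≤1) y≡ G≤x x≤F =
      rhombus-at (1ℚ - ρ) (t + ρ) (0≤1-ρ , 1-ρ≤1) (0≤t+ρ , t+ρ≤1) x≡ y≡′
      where
      v : ℚ
      v = x - ((S + A) + t * B)
      v≤[1-t]D : v ℚ.≤ (1ℚ - t) * D
      v≤[1-t]D = ≤-byDifference (((S + B) + t * A) - x)
        (solve 5 (λ x S t A B → (con 1ℚ :- t) :* (B :- A) :- (x :- ((S :+ A) :+ t :* B)) := ((S :+ B) :+ t :* A) :- x)
                 refl x S t A B)
        (p≤q⇒0≤q-p x≤F)
      ρ : ℚ
      ρ = v * D⁻¹
      0≤ρ : 0ℚ ℚ.≤ ρ
      0≤ρ = ÷D-nonNeg (p≤q⇒0≤q-p G≤x)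
      ρ≤1-t : ρ ℚ.≤ 1ℚ - t
      ρ≤1-t = ÷D-≤ v≤[1-t]D
      0≤t+ρ : 0ℚ ℚ.≤ t + ρ
      0≤t+ρ = ℚ.+-mono-≤ 0≤t 0≤ρ
      t+ρ≤1 : t + ρ ℚ.≤ 1ℚ
      t+ρ≤1 = ≤-byDifference ((1ℚ - t) - ρ) (solve 2 (λ t ρ → con 1ℚ :- (t :+ ρ) := (con 1ℚ :- t) :- ρ) refl t ρ)
                (p≤q⇒0≤q-p ρ≤1-t)
      0≤1-ρ : 0ℚ ℚ.≤ 1ℚ - ρ
      0≤1-ρ = p≤q⇒0≤q-p {ρ} {1ℚ} (ℚ.≤-trans ρ≤1-t
                (≤-byDifference {1ℚ - t} t (solve 1 (λ t → con 1ℚ :- (con 1ℚ :- t) := t) refl t) 0≤t))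
      1-ρ≤1 : 1ℚ - ρ ℚ.≤ 1ℚ
      1-ρ≤1 = ≤-byDifference ρ (solve 1 (λ ρ → con 1ℚ :- (con 1ℚ :- ρ) := ρ) refl ρ) 0≤ρ
      x≡ : x ≡ rhombusX (1ℚ - ρ) (t + ρ)
      x≡ = begin
        x                          ≡⟨ solve 2 (λ x c → x := c :+ (x :- c)) refl x ((S + A) + t * B) ⟩
        ((S + A) + t * B) + v      ≡⟨ cong (((S + A) + t * B) +_) (sym (÷D-inverse v)) ⟩
        ((S + A) + t * B) + ρ * D  ≡⟨ solve 5 (λ S t A B ρ → ((S :+ A) :+ t :* B) :+ ρ :* (B :- A)
                                                          := (S :+ (con 1ℚ :- ρ) :* A) :+ (t :+ ρ) :* B) refl S t A B ρ ⟩
        rhombusX (1ℚ - ρ) (t + ρ)  ∎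
        where open ≡-Reasoning
      y≡′ : y ≡ - (ℕ→ℚ i + ((1ℚ - ρ) + (t + ρ)))
      y≡′ = trans y≡ (trans (cong (λ c → - (c + t)) (ℕ→ℚ-suc i))
        (solve 3 (λ c t ρ → :- ((c :+ con 1ℚ) :+ t) := :- (c :+ ((con 1ℚ :- ρ) :+ (t :+ ρ)))) refl (ℕ→ℚ i) t ρ))

    gap⊆rhombus : ∀ x y k t → InI t → y ≡ - (ℕ→ℚ k + t) → right G k t ℚ.≤ x → x ℚ.≤ right F k t →
                  right G k t ℚ.< right F k t → Rhombus InI (vertex F i) a b (x , y)
    gap⊆rhombus x y k t It y≡ G≤x x≤F G<F = by-position (position k i)
      where
      by-position : Position k i → Rhombus InI (vertex F i) a b (x , y)
      by-position (below k<i)   = ⊥-elim (ℚ.<-irrefl (uncurry (right-G-other k t) (below⇒outside k<i)) G<F)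
      by-position (above 2+i≤k) = ⊥-elim (ℚ.<-irrefl (uncurry (right-G-other k t) (above⇒outside 2+i≤k)) G<F)
      by-position (at refl)     = gap⊆rhombus-at-i x y t It y≡ (subst (ℚ._≤ x) (right-G-i t) G≤x) x≤F
      by-position (at-suc refl) =
        gap⊆rhombus-at-suc-i x y t It y≡ (subst (ℚ._≤ x) (right-G-suc-i t) G≤x) (subst (x ℚ.≤_) (right-F-suc-i t) x≤F)

    prefixSum-G<prefixSum-F : prefixSum G (suc i) ℚ.< prefixSum F (suc i)
    prefixSum-G<prefixSum-F = subst₂ ℚ._<_ (sym prefixSum-G-suc-i) (sym (prefixSum-suc F i))
      (<-byDifference D (solve 3 (λ S A B → (S :+ B) :- (S :+ A) := B :- A) refl S A B) 0<D)

    vertex∈rhombus : Rhombus InI (vertex F i) a b (vertex F i)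
    vertex∈rhombus = 0ℚ , 0ℚ , 0∈I , 0∈I , cong₂ _,_
      (solve 3 (λ S A B → S := (S :+ con 0ℚ :* A) :+ con 0ℚ :* B) refl S A B)
      (solve 1 (λ c → :- c := (:- c :+ con 0ℚ :* con (- 1ℚ)) :+ con 0ℚ :* con (- 1ℚ)) refl (ℕ→ℚ i))

    farCorner : Point
    farCorner = (vertex F i ⊕ edge a) ⊕ edge b

    farCorner∈rhombus : Rhombus InI (vertex F i) a b farCorner
    farCorner∈rhombus = 1ℚ , 1ℚ , 1∈I , 1∈I , cong₂ _,_
      (cong₂ (λ u v → (S + u) + v) (sym (ℚ.*-identityˡ A)) (sym (ℚ.*-identityˡ B)))
      (cong₂ (λ u v → (- ℕ→ℚ i + u) + v) (sym (ℚ.*-identityˡ (- 1ℚ))) (sym (ℚ.*-identityˡ (- 1ℚ))))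

    farCorner≡ : farCorner ≡ (prefixSum F (suc (suc i)) , - ℕ→ℚ (suc (suc i)))
    farCorner≡ = cong₂ _,_
      (trans (solve 3 (λ S A B → (S :+ A) :+ B := (S :+ B) :+ A) refl S A B)
        (sym (trans (prefixSum-suc F (suc i)) (cong (_+ A) (prefixSum-suc F i)))))
      (trans (solve 1 (λ c → (:- c :+ con (- 1ℚ)) :+ con (- 1ℚ) := :- ((c :+ con 1ℚ) :+ con 1ℚ)) refl (ℕ→ℚ i))
        (cong -_ (sym (trans (ℕ→ℚ-suc (suc i)) (cong (_+ 1ℚ) (ℕ→ℚ-suc i))))))

  Covered : List (Tile N) → Point → Set
  Covered ts q = Any (λ T → InTile T q) ts

  rhombusTile : Point → (A B : ℕ) → A < B → B < N → Tile N
  rhombusTile P A B A<B B<N = tile P (Fin.fromℕ< (ℕ.<-trans A<B B<N)) (Fin.fromℕ< B<N)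
    (subst₂ _<_ (sym (Fin.toℕ-fromℕ< (ℕ.<-trans A<B B<N))) (sym (Fin.toℕ-fromℕ< B<N)) A<B)

  relabel : ∀ {I P A A′ B B′ q} → A ≡ A′ → B ≡ B′ → Rhombus I P A B q → Rhombus I P A′ B′ q
  relabel refl refl q∈ = q∈

  module _ (P : Point) {A B : ℕ} (A<B : A < B) (B<N : B < N) where

    rhombusTile-a : Fin.toℕ (Tile.a (rhombusTile P A B A<B B<N)) ≡ A
    rhombusTile-a = Fin.toℕ-fromℕ< (ℕ.<-trans A<B B<N)

    rhombusTile-b : Fin.toℕ (Tile.b (rhombusTile P A B A<B B<N)) ≡ B
    rhombusTile-b = Fin.toℕ-fromℕ< B<N

    InTile⇒rhombus : ∀ {q} → InTile (rhombusTile P A B A<B B<N) q → Rhombus InI P A B q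
    InTile⇒rhombus = relabel {P = P} rhombusTile-a rhombusTile-b

    InTileInterior⇒rhombus : ∀ {q} → InTileInterior (rhombusTile P A B A<B B<N) q → Rhombus InIo P A B q
    InTileInterior⇒rhombus = relabel {P = P} rhombusTile-a rhombusTile-b

    rhombus⇒InTile : ∀ {q} → Rhombus InI P A B q → InTile (rhombusTile P A B A<B B<N) q
    rhombus⇒InTile = relabel {P = P} (sym rhombusTile-a) (sym rhombusTile-b)

    rhombusTile-farCorner : tileFarCorner (rhombusTile P A B A<B B<N) ≡ (P ⊕ edge A) ⊕ edge B
    rhombusTile-farCorner = cong₂ (λ A B → (P ⊕ edge A) ⊕ edge B) rhombusTile-a rhombusTile-b

  -- A reduced word for F: every step swaps a descent, and the last permutation is the identity.
  data Chain : (ℕ → ℕ) → Set where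
    done : ∀ {F} → Fixes F N → Chain F
    step : ∀ {F} i → suc i < N → F (suc i) < F i → F i < N → Chain (λ p → F (swap i p)) → Chain F

  tiles : ∀ {F} → Chain F → List (Tile N)
  tiles (done _) = []
  tiles {F} (step i _ descent Fi<N c) = rhombusTile (vertex F i) (F (suc i)) (F i) descent Fi<N ∷ tiles c

  -- The two boundaries of X(F) meet at height r.
  Touches : (ℕ → ℕ) → ℕ → Set
  Touches F r = prefixSum F r ≡ prefixSum (λ p → p) r

  right-at-1 : ∀ F k → right F k 1ℚ ≡ prefixSum F (suc k)
  right-at-1 F k = trans (cong (prefixSum F k +_) (ℚ.*-identityˡ _)) (sym (prefixSum-suc F k))

  right-identity : ∀ {F} → Fixes F N → ∀ k t → k < N → right F k t ≡ left k t
  right-identity F≗id k t k<N =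
    cong₂ (λ s v → s + t * ℕ→ℚ v) (prefixSum-cong k (λ p p<k → F≗id p (ℕ.<-trans p<k k<N))) (F≗id k k<N)

  ordered⇒prefixSum-≥ : ∀ {F} → BoundariesOrdered F → ∀ r → r ≤ N → prefixSum (λ p → p) r ℚ.≤ prefixSum F r
  ordered⇒prefixSum-≥ ordered zero    _     = ℚ.≤-refl
  ordered⇒prefixSum-≥ ordered (suc k) 1+k≤N =
    subst₂ ℚ._≤_ (right-at-1 (λ p → p) k) (right-at-1 _ k) (ordered k 1ℚ 1+k≤N 1∈I)

  chain-ordered : ∀ {F} → Chain F → BoundariesOrdered F
  chain-ordered (done F≗id) k t k<N _ = ℚ.≤-reflexive (sym (right-identity F≗id k t k<N))
  chain-ordered {F} (step i 1+i<N descent _ c) k t k<N It =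
    ℚ.≤-trans (chain-ordered c k t k<N It) (Descent.right-G≤right-F F i 1+i<N descent k t It)

  chain-touches-N : ∀ {F} → Chain F → Touches F N
  chain-touches-N (done F≗id) = prefixSum-cong N F≗id
  chain-touches-N {F} (step i 1+i<N _ _ c) =
    trans (sym (prefixSum-swap i N F (λ { refl → ℕ.<-irrefl refl 1+i<N }))) (chain-touches-N c)

  chain-touches⇒stable : ∀ {F} → Chain F → ∀ r → r ≤ N → Touches F r → StablePrefix F r
  chain-touches⇒stable (done F≗id) r r≤N _ = StablePrefix-identity (λ p p<r → F≗id p (ℕ.<-≤-trans p<r r≤N))
  chain-touches⇒stable {F} (step i 1+i<N descent _ c) r r≤N touches = by-cases (r ℕ.≟ suc i)
    where
    open Descent F i 1+i<N descent using (G; prefixSum-G<prefixSum-F)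
    by-cases : Dec (r ≡ suc i) → StablePrefix F r
    by-cases (yes refl) = ⊥-elim (ℚ.<-irrefl (sym touches)
      (ℚ.≤-<-trans (ordered⇒prefixSum-≥ (chain-ordered c) (suc i) r≤N) prefixSum-G<prefixSum-F))
    by-cases (no r≢1+i) =
      StablePrefix-swap F i r r≢1+i (chain-touches⇒stable c r r≤N (trans (prefixSum-swap i r F r≢1+i) touches))

  tiles⊆region : ∀ {F} (c : Chain F) j q → InTile (lookup (tiles c) j) q → InRegion F q
  tiles⊆region {F} (step i 1+i<N descent Fi<N c) zero q q∈T =
    Descent.rhombus⊆region F i 1+i<N descent (chain-ordered c) q (InTile⇒rhombus (vertex F i) descent Fi<N q∈T)
  tiles⊆region {F} (step i 1+i<N descent Fi<N c) (Fin.suc j) q q∈T =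
    Descent.region-G⊆region-F F i 1+i<N descent q (tiles⊆region c j q q∈T)

  interior⊆tile : ∀ (T : Tile N) q → InTileInterior T q → InTile T q
  interior⊆tile T q (s , u , (0<s , s<1) , (0<u , u<1) , q≡) =
    s , u , (ℚ.<⇒≤ 0<s , ℚ.<⇒≤ s<1) , (ℚ.<⇒≤ 0<u , ℚ.<⇒≤ u<1) , q≡

  tiles-disjoint : ∀ {F} (c : Chain F) j j′ q → ¬ j ≡ j′ →
                   InTileInterior (lookup (tiles c) j) q → ¬ InTileInterior (lookup (tiles c) j′) q
  tiles-disjoint (step i 1+i<N descent Fi<N c) zero    zero     q j≢j′ _ _ = j≢j′ refl
  tiles-disjoint {F} (step i 1+i<N descent Fi<N c) zero    (Fin.suc j′) q _ q∈T° q∈T′° =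
    Descent.rhombus°∩region-G≡∅ F i 1+i<N descent q (InTileInterior⇒rhombus (vertex F i) descent Fi<N q∈T°)
      (tiles⊆region c j′ q (interior⊆tile (lookup (tiles c) j′) q q∈T′°))
  tiles-disjoint {F} (step i 1+i<N descent Fi<N c) (Fin.suc j) zero     q _ q∈T° q∈T′° =
    Descent.rhombus°∩region-G≡∅ F i 1+i<N descent q (InTileInterior⇒rhombus (vertex F i) descent Fi<N q∈T′°)
      (tiles⊆region c j q (interior⊆tile (lookup (tiles c) j) q q∈T°))
  tiles-disjoint (step i 1+i<N descent Fi<N c) (Fin.suc j) (Fin.suc j′) q j≢j′ =
    tiles-disjoint c j j′ q (λ j≡j′ → j≢j′ (cong Fin.suc j≡j′))

  tiles-cover-wide : ∀ {F} (c : Chain F) q → InRegionWide F q → Covered (tiles c) q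
  tiles-cover-wide (done F≗id) q (k , k<N , t , _ , left<right) =
    ⊥-elim (ℚ.<-irrefl (sym (right-identity F≗id k t k<N)) left<right)
  tiles-cover-wide {F} (step i 1+i<N descent Fi<N c) (x , y) (k , k<N , t , (It , y≡ , left≤x , x≤right) , left<right) =
    by-cases (right G k t ℚ.<? x) (left k t ℚ.<? right G k t)
    where
    open Descent F i 1+i<N descent using (G; gap⊆rhombus)
    covered-by-head : right G k t ℚ.≤ x → right G k t ℚ.< right F k t → Covered (tiles (step i 1+i<N descent Fi<N c)) (x , y)
    covered-by-head G≤x G<F = here (rhombus⇒InTile (vertex F i) descent Fi<N (gap⊆rhombus x y k t It y≡ G≤x x≤right G<F))
    by-cases : Dec (right G k t ℚ.< x) → Dec (left k t ℚ.< right G k t) → Covered (tiles (step i 1+i<N descent Fi<N c)) (x , y)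
    by-cases (yes G<x) _ = covered-by-head (ℚ.<⇒≤ G<x) (ℚ.<-≤-trans G<x x≤right)
    by-cases (no G≮x) (yes left<G) =
      there (tiles-cover-wide c (x , y) (k , k<N , t , (It , y≡ , left≤x , ℚ.≮⇒≥ G≮x) , left<G))
    by-cases (no _) (no left≮G) =
      covered-by-head (ℚ.≤-trans (ℚ.≮⇒≥ left≮G) left≤x) (ℚ.≤-<-trans (ℚ.≮⇒≥ left≮G) left<right)

  tiles-cover-origin : ∀ {F} (c : Chain F) → 0 < N → ¬ F 0 ≡ 0 → Covered (tiles c) origin
  tiles-cover-origin (done F≗id) 0<N F0≢0 = ⊥-elim (F0≢0 (F≗id 0 0<N))
  tiles-cover-origin {F} (step i 1+i<N descent Fi<N c) 0<N F0≢0 = by-cases (i ℕ.≟ 0)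
    where
    open Descent F i 1+i<N descent using (vertex∈rhombus)
    by-cases : Dec (i ≡ 0) → Covered (tiles (step i 1+i<N descent Fi<N c)) origin
    by-cases (yes refl) = here (rhombus⇒InTile (vertex F i) descent Fi<N vertex∈rhombus)
    by-cases (no i≢0)   = there (tiles-cover-origin c 0<N
      (λ G0≡0 → F0≢0 (trans (cong F (sym (swap-other i 0 (λ 0≡i → i≢0 (sym 0≡i)) (λ ()))) ) G0≡0)))

  bottomVertex : Point
  bottomVertex = (prefixSum (λ p → p) N , - ℕ→ℚ N)

  tiles-cover-bottom : ∀ {F} (c : Chain F) m → N ≡ suc m → ¬ F m ≡ m → Covered (tiles c) bottomVertex
  tiles-cover-bottom (done F≗id) m refl Fm≢m = ⊥-elim (Fm≢m (F≗id m (ℕ.n<1+n m)))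
  tiles-cover-bottom {F} (step i 1+i<N descent Fi<N c) m refl Fm≢m = by-cases (suc i ℕ.≟ m)
    where
    open Descent F i 1+i<N descent using (farCorner; farCorner∈rhombus; farCorner≡)
    by-cases : Dec (suc i ≡ m) → Covered (tiles (step i 1+i<N descent Fi<N c)) bottomVertex
    by-cases (yes refl) = here (rhombus⇒InTile (vertex F i) descent Fi<N
      (subst (Rhombus InI (vertex F i) (F (suc i)) (F i)) farCorner≡bottom farCorner∈rhombus))
      where
      farCorner≡bottom : farCorner ≡ bottomVertex
      farCorner≡bottom = trans farCorner≡ (cong (_, - ℕ→ℚ (suc (suc i))) (chain-touches-N {F} (step i 1+i<N descent Fi<N c)))
    by-cases (no 1+i≢m) = there (tiles-cover-bottom c m refl
      (λ Gm≡m → Fm≢m (trans (cong F (sym (swap-other i m m≢i (λ m≡1+i → 1+i≢m (sym m≡1+i))))) Gm≡m)))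
      where
      m≢i : ¬ m ≡ i
      m≢i refl = ℕ.<-irrefl refl (ℕ.≤-pred 1+i<N)

  excess : (ℕ → ℕ) → ℕ → ℚ
  excess F r = prefixSum F r - prefixSum (λ p → p) r

  right-left-interpolation : ∀ F k t → right F k t - left k t ≡ (1ℚ - t) * excess F k + t * excess F (suc k)
  right-left-interpolation F k t rewrite prefixSum-suc F k | prefixSum-suc (λ p → p) k =
    solve 5 (λ SF SI f c t → (SF :+ t :* f) :- (SI :+ t :* c) := (con 1ℚ :- t) :* (SF :- SI) :+ t :* ((SF :+ f) :- (SI :+ c)))
      refl (prefixSum F k) (prefixSum (λ p → p) k) (ℕ→ℚ (F k)) (ℕ→ℚ k) t

  pinch⇒excesses-vanish : ∀ {F} → BoundariesOrdered F → ∀ k t → k < N → InI t → right F k t ℚ.≤ left k t →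
                      (1ℚ - t) * excess F k ≡ 0ℚ × t * excess F (suc k) ≡ 0ℚ
  pinch⇒excesses-vanish {F} ordered k t k<N (0≤t , t≤1) right≤left =
    nonNeg+nonNeg≤0 (*-nonNeg (p≤q⇒0≤q-p t≤1) (0≤excess k (ℕ.<⇒≤ k<N))) (*-nonNeg 0≤t (0≤excess (suc k) k<N))
      (subst (ℚ._≤ 0ℚ) (right-left-interpolation F k t)
        (≤-byDifference (left k t - right F k t) (solve 2 (λ R L → con 0ℚ :- (R :- L) := L :- R) refl (right F k t) (left k t))
          (p≤q⇒0≤q-p right≤left)))
    where
    0≤excess : ∀ r → r ≤ N → 0ℚ ℚ.≤ excess F r
    0≤excess r r≤N = p≤q⇒0≤q-p (ordered⇒prefixSum-≥ ordered r r≤N)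

  excess-vanishes-at-ends : ∀ {F} → (∀ r → 1 ≤ r → r < N → ¬ Touches F r) →
                            ∀ r → r ≤ N → excess F r ≡ 0ℚ → r ≡ 0 ⊎ r ≡ N
  excess-vanishes-at-ends untouched zero    _     _     = inj₁ refl
  excess-vanishes-at-ends untouched (suc r) 1+r≤N excess≡0 = by-cases (suc r ℕ.≟ N)
    where
    by-cases : Dec (suc r ≡ N) → suc r ≡ 0 ⊎ suc r ≡ N
    by-cases (yes 1+r≡N) = inj₂ 1+r≡N
    by-cases (no 1+r≢N)  =
      ⊥-elim (untouched (suc r) (ℕ.s≤s ℕ.z≤n) (ℕ.≤∧≢⇒< 1+r≤N 1+r≢N) (p-q≡0⇒p≡q excess≡0))

  pinch⇒corner : ∀ {F} → 1 < N → BoundariesOrdered F → (∀ r → 1 ≤ r → r < N → ¬ Touches F r) →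
                 ∀ x y k t → k < N → InRegionAt F (x , y) k t → right F k t ℚ.≤ left k t →
                 (x , y) ≡ origin ⊎ (x , y) ≡ bottomVertex
  pinch⇒corner {F} 1<N ordered untouched x y k t k<N (It , y≡ , left≤x , x≤right) right≤left = by-t (t ℚ.≟ 0ℚ)
    where
    vanish : (1ℚ - t) * excess F k ≡ 0ℚ × t * excess F (suc k) ≡ 0ℚ
    vanish = pinch⇒excesses-vanish ordered k t k<N It right≤left

    on-left : (x , y) ≡ (left k t , - (ℕ→ℚ k + t))
    on-left = cong₂ _,_ (ℚ.≤-antisym (ℚ.≤-trans x≤right right≤left) left≤x) y≡

    at-origin : k ≡ 0 ⊎ k ≡ N → t ≡ 0ℚ → (x , y) ≡ origin
    at-origin (inj₁ refl) refl = on-left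
    at-origin (inj₂ refl) _    = ⊥-elim (ℕ.<-irrefl refl k<N)

    at-bottom : suc k ≡ 0 ⊎ suc k ≡ N → t ≡ 1ℚ → (x , y) ≡ bottomVertex
    at-bottom (inj₂ refl) refl = trans on-left (cong₂ _,_ (right-at-1 (λ p → p) k) (cong -_ (sym (ℕ→ℚ-suc k))))

    inside : k ≡ 0 ⊎ k ≡ N → suc k ≡ 0 ⊎ suc k ≡ N → ⊥
    inside (inj₁ refl) (inj₂ refl) = ℕ.<-irrefl refl 1<N
    inside (inj₂ refl) _           = ℕ.<-irrefl refl k<N

    by-t<1 : 0ℚ ℚ.< t → Dec (t ℚ.< 1ℚ) → (x , y) ≡ origin ⊎ (x , y) ≡ bottomVertex
    by-t<1 0<t t<1? = by-cases t<1?
      where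
      lower-end : suc k ≡ 0 ⊎ suc k ≡ N
      lower-end = excess-vanishes-at-ends untouched (suc k) k<N (pos*q≡0⇒q≡0 0<t (proj₂ vanish))
      by-cases : Dec (t ℚ.< 1ℚ) → (x , y) ≡ origin ⊎ (x , y) ≡ bottomVertex
      by-cases (yes t<1) = ⊥-elim (inside
        (excess-vanishes-at-ends untouched k (ℕ.<⇒≤ k<N) (pos*q≡0⇒q≡0 (p<q⇒0<q-p t<1) (proj₁ vanish))) lower-end)
      by-cases (no t≮1)  = inj₂ (at-bottom lower-end (ℚ.≤-antisym (proj₂ It) (ℚ.≮⇒≥ t≮1)))

    by-t : Dec (t ≡ 0ℚ) → (x , y) ≡ origin ⊎ (x , y) ≡ bottomVertex
    by-t (yes refl) = inj₁ (at-origin (excess-vanishes-at-ends untouched k (ℕ.<⇒≤ k<N)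
      (pos*q≡0⇒q≡0 (ℚ.positive⁻¹ 1ℚ) (proj₁ vanish))) refl)
    by-t (no t≢0)   = by-t<1 (≤∧≢⇒< (proj₁ It) (λ 0≡t → t≢0 (sym 0≡t))) (t ℚ.<? 1ℚ)

  record InverseOn (F G : ℕ → ℕ) : Set where
    field
      F-< : ∀ p → p < N → F p < N
      G-< : ∀ v → v < N → G v < N
      G∘F : ∀ p → p < N → G (F p) ≡ p
      F∘G : ∀ v → v < N → F (G v) ≡ v

    F-injective : ∀ {p p′} → p < N → p′ < N → F p ≡ F p′ → p ≡ p′
    F-injective {p} {p′} p<N p′<N Fp≡Fp′ = trans (sym (G∘F p p<N)) (trans (cong G Fp≡Fp′) (G∘F p′ p′<N))

  InverseOn-swap : ∀ {F G} i → suc i < N → InverseOn F G → InverseOn (λ p → F (swap i p)) (λ v → swap i (G v))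
  InverseOn-swap {F} {G} i 1+i<N inv = record
    { F-< = λ p p<N → F-< (swap i p) (swap-< i p N N≢1+i p<N)
    ; G-< = λ v v<N → swap-< i (G v) N N≢1+i (G-< v v<N)
    ; G∘F = λ p p<N → trans (cong (swap i) (G∘F (swap i p) (swap-< i p N N≢1+i p<N))) (swap-involutive i p)
    ; F∘G = λ v v<N → trans (cong F (swap-involutive i (G v))) (F∘G v v<N)
    }
    where
    open InverseOn inv
    N≢1+i : ¬ N ≡ suc i
    N≢1+i refl = ℕ.<-irrefl refl 1+i<N

  Fixes⇒≥ : ∀ {F G m p} → InverseOn F G → Fixes F m → m ≤ p → p < N → m ≤ F p
  Fixes⇒≥ {F} {m = m} {p} inv fixes m≤p p<N with m ℕ.≤? F p
  ... | yes m≤Fp = m≤Fp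
  ... | no m≰Fp = ⊥-elim (ℕ.<-irrefl Fp≡p (ℕ.<-≤-trans (ℕ.≰⇒> m≰Fp) m≤p))
    where
    Fp≡p : F p ≡ p
    Fp≡p = InverseOn.F-injective inv (InverseOn.F-< inv p p<N) p<N (fixes (F p) (ℕ.≰⇒> m≰Fp))

  Fixes-swap : ∀ {F m} i → m ≤ i → Fixes F m → Fixes (λ p → F (swap i p)) m
  Fixes-swap {F} i m≤i fixes p p<m =
    trans (cong F (swap-other i p (λ { refl → ℕ.<-irrefl refl (ℕ.<-≤-trans p<m m≤i) })
                                  (λ { refl → ℕ.<-irrefl refl (ℕ.<-≤-trans p<m (ℕ.m≤n⇒m≤1+n m≤i)) })))
          (fixes p p<m)

  -- Selection sort: with F fixing [0, m), bubble the value m down from position G m to m.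
  -- Positions are written d + m, not m + d, so that suc d + m reduces to suc (d + m).
  mutual
    sortFrom : ∀ {F G} k m → k ℕ.+ m ≡ N → InverseOn F G → Fixes F m → Chain F
    sortFrom zero    m m≡N _ fixes = done (λ p p<N → fixes p (subst (p <_) (sym m≡N) p<N))
    sortFrom {F} {G} (suc k) m 1+k+m≡N inv fixes =
      bubbleDown k (G m ℕ.∸ m) m 1+k+m≡N inv fixes (trans (cong F G[m]∸m+m≡G[m]) (F∘G m m<N))
        (subst (_< N) (sym G[m]∸m+m≡G[m]) (G-< m m<N))
      where
      open InverseOn inv
      m<N : m < N
      m<N = subst (m <_) 1+k+m≡N (ℕ.m<n+m m (ℕ.s≤s ℕ.z≤n))
      G[m]∸m+m≡G[m] : (G m ℕ.∸ m) ℕ.+ m ≡ G m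
      G[m]∸m+m≡G[m] = ℕ.m∸n+n≡m m≤G[m]
        where
        m≤G[m] : m ≤ G m
        m≤G[m] with m ℕ.≤? G m
        ... | yes m≤G[m] = m≤G[m]
        ... | no m≰G[m]  =
          ⊥-elim (ℕ.<-irrefl (trans (sym (fixes (G m) (ℕ.≰⇒> m≰G[m]))) (F∘G m m<N)) (ℕ.≰⇒> m≰G[m]))

    bubbleDown : ∀ {F G} k d m → suc k ℕ.+ m ≡ N → InverseOn F G → Fixes F m →
                 F (d ℕ.+ m) ≡ m → d ℕ.+ m < N → Chain F
    bubbleDown k zero m 1+k+m≡N inv fixes Fm≡m _ =
      sortFrom k (suc m) (trans (ℕ.+-suc k m) 1+k+m≡N) inv fixes′
      where
      fixes′ : Fixes _ (suc m)
      fixes′ p p<1+m with ℕ.m≤n⇒m<n∨m≡n (ℕ.≤-pred p<1+m)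
      ... | inj₁ p<m  = fixes p p<m
      ... | inj₂ refl = Fm≡m
    bubbleDown {F} {G} k (suc d) m 1+k+m≡N inv fixes F[1+d+m]≡m 1+d+m<N =
      step (d ℕ.+ m) 1+d+m<N descent (F-< (d ℕ.+ m) i<N)
        (bubbleDown k d m 1+k+m≡N (InverseOn-swap (d ℕ.+ m) 1+d+m<N inv) (Fixes-swap (d ℕ.+ m) (ℕ.m≤n+m m d) fixes)
          (trans (cong F (swap-i (d ℕ.+ m))) F[1+d+m]≡m) i<N)
      where
      open InverseOn inv
      i<N : d ℕ.+ m < N
      i<N = ℕ.<-trans (ℕ.n<1+n _) 1+d+m<N
      descent : F (suc d ℕ.+ m) < F (d ℕ.+ m)
      descent = subst (_< F (d ℕ.+ m)) (sym F[1+d+m]≡m)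
        (ℕ.≤∧≢⇒< (Fixes⇒≥ inv fixes (ℕ.m≤n+m m d) i<N)
          (λ m≡Fi → ℕ.<-irrefl (sym (F-injective 1+d+m<N i<N (trans F[1+d+m]≡m m≡Fi))) (ℕ.n<1+n _)))

  sortChain : ∀ {F G} → InverseOn F G → Chain F
  sortChain inv = sortFrom _ 0 (ℕ.+-identityʳ N) inv (λ _ ())

  TileWithBase : Point → ℕ → ℕ → Tile N → Set
  TileWithBase P A B T = Tile.base T ≡ P × Fin.toℕ (Tile.a T) ≡ A × Fin.toℕ (Tile.b T) ≡ B

  bubbleDown-last-tile : ∀ {F G} k d m (e : suc k ℕ.+ m ≡ N) (inv : InverseOn F G) (fixes : Fixes F m)
    (eq : F (suc d ℕ.+ m) ≡ m) (lt : suc d ℕ.+ m < N) →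
    Any (TileWithBase (vertex F m) m (F m)) (tiles (bubbleDown k (suc d) m e inv fixes eq lt))
  bubbleDown-last-tile k zero m e inv fixes eq lt =
    here (refl , trans (Fin.toℕ-fromℕ< _) eq , Fin.toℕ-fromℕ< _)
  bubbleDown-last-tile {F} k (suc d) m e inv fixes eq lt =
    there (Any.map (λ { (base≡ , a≡ , b≡) → trans base≡ vertex≡ , a≡ , trans b≡ Fm≡ })
                   (bubbleDown-last-tile k d m e _ _ _ _))
    where
    i : ℕ
    i = suc d ℕ.+ m
    m≢i : ¬ m ≡ i
    m≢i m≡i = ℕ.<-irrefl m≡i (ℕ.s≤s (ℕ.m≤n+m m d))
    m≢1+i : ¬ m ≡ suc i
    m≢1+i m≡1+i = ℕ.<-irrefl m≡1+i (ℕ.<-trans (ℕ.s≤s (ℕ.m≤n+m m d)) (ℕ.n<1+n i))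
    vertex≡ : vertex (λ p → F (swap i p)) m ≡ vertex F m
    vertex≡ = cong (_, - ℕ→ℚ m) (prefixSum-swap i m F m≢1+i)
    Fm≡ : F (swap i m) ≡ F m
    Fm≡ = cong F (swap-other i m m≢i m≢1+i)

  topChain : ∀ {F G} → 0 < N → InverseOn F G → ¬ F 0 ≡ 0 →
             Σ (Chain F) λ c → Any (TileWithBase origin 0 (F 0)) (tiles c)
  topChain {F} {G} 0<N inv F0≢0 = from-position (G 0) refl
    where
    open InverseOn inv
    N≡1+k : suc (ℕ.pred N) ℕ.+ 0 ≡ N
    N≡1+k = trans (ℕ.+-identityʳ _) (ℕ.suc-pred N {{ℕ.>-nonZero 0<N}})
    from-position : ∀ j → G 0 ≡ j → Σ (Chain F) λ c → Any (TileWithBase origin 0 (F 0)) (tiles c)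
    from-position zero    G0≡0   = ⊥-elim (F0≢0 (trans (cong F (sym G0≡0)) (F∘G 0 0<N)))
    from-position (suc d) G0≡1+d = bubbleDown _ (suc d) 0 N≡1+k inv (λ _ ()) F[1+d]≡0 1+d<N ,
                                   bubbleDown-last-tile _ d 0 N≡1+k inv (λ _ ()) F[1+d]≡0 1+d<N
      where
      G0≡1+d+0 : G 0 ≡ suc d ℕ.+ 0
      G0≡1+d+0 = trans G0≡1+d (sym (ℕ.+-identityʳ (suc d)))
      F[1+d]≡0 : F (suc d ℕ.+ 0) ≡ 0
      F[1+d]≡0 = trans (cong F (sym G0≡1+d+0)) (F∘G 0 0<N)
      1+d<N : suc d ℕ.+ 0 < N
      1+d<N = subst (_< N) G0≡1+d+0 (G-< 0 0<N)

  maximum-descends : ∀ {F G n j} → InverseOn F G → N ≡ suc n → F j ≡ n → suc j < N → F (suc j) < F j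
  maximum-descends {F} {n = n} {j} inv N≡1+n Fj≡n 1+j<N = subst (F (suc j) <_) (sym Fj≡n)
    (ℕ.≤∧≢⇒< (ℕ.≤-pred (subst (F (suc j) <_) N≡1+n (F-< (suc j) 1+j<N)))
      (λ F[1+j]≡n → ℕ.<-irrefl (F-injective j<N 1+j<N (trans Fj≡n (sym F[1+j]≡n))) (ℕ.n<1+n j)))
    where
    open InverseOn inv
    j<N : j < N
    j<N = ℕ.<-trans (ℕ.n<1+n j) 1+j<N

  bubbleUp : ∀ {F G} n d j → N ≡ suc n → suc j ℕ.+ d ≡ n → InverseOn F G → F j ≡ n → Chain F
  bubbleUp {F} {G} n d j N≡1+n 1+j+d≡n inv Fj≡n =
    step j 1+j<N (maximum-descends inv N≡1+n Fj≡n 1+j<N) (InverseOn.F-< inv j (ℕ.<-trans (ℕ.n<1+n j) 1+j<N)) (rest d 1+j+d≡n)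
    where
    1+j<N : suc j < N
    1+j<N = subst (suc j <_) (sym N≡1+n) (ℕ.s≤s (subst (suc j ≤_) 1+j+d≡n (ℕ.m≤m+n (suc j) d)))
    inv′ : InverseOn (λ p → F (swap j p)) (λ v → swap j (G v))
    inv′ = InverseOn-swap j 1+j<N inv
    rest : ∀ d → suc j ℕ.+ d ≡ n → Chain (λ p → F (swap j p))
    rest zero    _         = sortChain inv′
    rest (suc d) 1+j+1+d≡n = bubbleUp n d (suc j) N≡1+n (trans (sym (ℕ.+-suc (suc j) d)) 1+j+1+d≡n) inv′
                               (trans (cong F (swap-suc-i j)) Fj≡n)

  TileWithFarCorner : ℚ → ℕ → ℕ → Tile N → Set
  TileWithFarCorner Σ A B T = tileFarCorner T ≡ (Σ , - ℕ→ℚ N) × Fin.toℕ (Tile.a T) ≡ A × Fin.toℕ (Tile.b T) ≡ B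

  bubbleUp-last-tile : ∀ {F G} n d j (N≡1+n : N ≡ suc n) (1+j+d≡n : suc j ℕ.+ d ≡ n)
                       (inv : InverseOn F G) (Fj≡n : F j ≡ n) →
                       Any (TileWithFarCorner (prefixSum F N) (F n) n) (tiles (bubbleUp n d j N≡1+n 1+j+d≡n inv Fj≡n))
  bubbleUp-last-tile {F} n zero j N≡1+n 1+j+0≡n inv Fj≡n =
    here (corner≡ , trans (Fin.toℕ-fromℕ< _) (cong F 1+j≡n) , trans (Fin.toℕ-fromℕ< _) Fj≡n)
    where
    1+j≡n : suc j ≡ n
    1+j≡n = trans (sym (ℕ.+-identityʳ (suc j))) 1+j+0≡n
    2+j≡N : suc (suc j) ≡ N
    2+j≡N = trans (cong suc 1+j≡n) (sym N≡1+n)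
    1+j<N : suc j < N
    1+j<N = subst (suc j <_) 2+j≡N (ℕ.n<1+n (suc j))
    descent : F (suc j) < F j
    descent = maximum-descends inv N≡1+n Fj≡n 1+j<N
    corner≡ : tileFarCorner (lookup (tiles (bubbleUp n zero j N≡1+n 1+j+0≡n inv Fj≡n)) zero) ≡
              (prefixSum F N , - ℕ→ℚ N)
    corner≡ = trans (rhombusTile-farCorner (vertex F j) descent (InverseOn.F-< inv j (ℕ.<-trans (ℕ.n<1+n j) 1+j<N)))
      (trans (Descent.farCorner≡ F j 1+j<N descent)
        (cong (λ r → (prefixSum F r , - ℕ→ℚ r)) 2+j≡N))
  bubbleUp-last-tile {F} n (suc d) j N≡1+n 1+j+1+d≡n inv Fj≡n =
    there (Any.map (λ { (corner≡ , a≡ , b≡) → trans corner≡ (cong (_, - ℕ→ℚ N) sum≡) , trans a≡ Fn≡ , b≡ })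
                   (bubbleUp-last-tile n d (suc j) N≡1+n _ _ _))
    where
    2+j≤n : suc (suc j) ≤ n
    2+j≤n = subst (suc (suc j) ≤_) (trans (sym (ℕ.+-suc (suc j) d)) 1+j+1+d≡n) (ℕ.s≤s (ℕ.m≤m+n (suc j) d))
    sum≡ : prefixSum (λ p → F (swap j p)) N ≡ prefixSum F N
    sum≡ = prefixSum-swap j N F
      (λ N≡1+j → ℕ.<-irrefl (ℕ.suc-injective (trans (sym N≡1+j) N≡1+n)) (ℕ.<-trans (ℕ.n<1+n j) 2+j≤n))
    Fn≡ : F (swap j n) ≡ F n
    Fn≡ = cong F (swap-other j n (λ { refl → ℕ.<-irrefl refl (ℕ.<-trans (ℕ.n<1+n j) 2+j≤n) })
                                 (λ { refl → ℕ.<-irrefl refl 2+j≤n }))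

  bottomChain : ∀ {F G} n → N ≡ suc n → InverseOn F G → ¬ F n ≡ n →
                Σ (Chain F) λ c → Any (TileWithFarCorner (prefixSum F N) (F n) n) (tiles c)
  bottomChain {F} {G} n N≡1+n inv Fn≢n =
    bubbleUp n (n ℕ.∸ suc j) j N≡1+n 1+j+d≡n inv Fj≡n , bubbleUp-last-tile n (n ℕ.∸ suc j) j N≡1+n 1+j+d≡n inv Fj≡n
    where
    open InverseOn inv
    n<N : n < N
    n<N = subst (n <_) (sym N≡1+n) (ℕ.n<1+n n)
    j : ℕ
    j = G n
    Fj≡n : F j ≡ n
    Fj≡n = F∘G n n<N
    j<n : j < n
    j<n = ℕ.≤∧≢⇒< (ℕ.≤-pred (subst (j <_) N≡1+n (G-< n n<N))) (λ j≡n → Fn≢n (trans (cong F (sym j≡n)) Fj≡n))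
    1+j+d≡n : suc j ℕ.+ (n ℕ.∸ suc j) ≡ n
    1+j+d≡n = ℕ.m+[n∸m]≡n j<n

module Elnitsky (n : ℕ) (w : Permutation′ (suc n)) where
  open Region (suc n)

  π π⁻¹ : ℕ → ℕ
  π   = extend (λ i → Fin.toℕ (w ⟨$⟩ʳ i))
  π⁻¹ = extend (λ i → Fin.toℕ (w ⟨$⟩ˡ i))

  π-inverse : InverseOn π π⁻¹
  π-inverse = record
    { F-< = λ p p<N → subst (_< suc n) (sym (extend-fromℕ< _ p<N)) (Fin.toℕ<n _)
    ; G-< = λ v v<N → subst (_< suc n) (sym (extend-fromℕ< _ v<N)) (Fin.toℕ<n _)
    ; G∘F = λ p p<N → trans (cong π⁻¹ (extend-fromℕ< _ p<N)) (trans (extend-toℕ _ (w ⟨$⟩ʳ Fin.fromℕ< p<N))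
                        (trans (cong Fin.toℕ (inverseˡ w)) (Fin.toℕ-fromℕ< p<N)))
    ; F∘G = λ v v<N → trans (cong π (extend-fromℕ< _ v<N)) (trans (extend-toℕ _ (w ⟨$⟩ˡ Fin.fromℕ< v<N))
                        (trans (cong Fin.toℕ (inverseʳ w)) (Fin.toℕ-fromℕ< v<N)))
    }

  leftX≡prefixSum : ∀ k → k ≤ suc n → leftX {suc n} k ≡ prefixSum (λ p → p) k
  leftX≡prefixSum k k≤N = trans (sumQ-take≡prefixSum (suc n) (λ i → i) Fin.toℕ k)
    (prefixSum-cong k (λ p p<k → extend-toℕ-identity (ℕ.<-≤-trans p<k k≤N)))

  rightX≡prefixSum : ∀ k → rightX w k ≡ prefixSum π k
  rightX≡prefixSum = sumQ-take≡prefixSum (suc n) (λ i → i) (λ i → Fin.toℕ (w ⟨$⟩ʳ i))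

  left-boundary : ∀ (k : Fin (suc n)) t → leftX {suc n} (Fin.toℕ k) + t * ℕ→ℚ (Fin.toℕ k) ≡ left (Fin.toℕ k) t
  left-boundary k t = cong (_+ t * ℕ→ℚ (Fin.toℕ k)) (leftX≡prefixSum (Fin.toℕ k) (ℕ.<⇒≤ (Fin.toℕ<n k)))

  right-boundary : ∀ (k : Fin (suc n)) t →
                   rightX w (Fin.toℕ k) + t * ℕ→ℚ (Fin.toℕ (w ⟨$⟩ʳ k)) ≡ right π (Fin.toℕ k) t
  right-boundary k t = cong₂ (λ s v → s + t * ℕ→ℚ v) (rightX≡prefixSum (Fin.toℕ k)) (sym (extend-toℕ _ k))

  InX⇒InRegion : ∀ q → InX w q → InRegion π q
  InX⇒InRegion q (k , t , It , y≡ , left≤x , x≤right) = Fin.toℕ k , Fin.toℕ<n k , t , It , y≡ ,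
    subst (ℚ._≤ proj₁ q) (left-boundary k t) left≤x , subst (proj₁ q ℚ.≤_) (right-boundary k t) x≤right

  InRegionAt⇒InX : ∀ q (k : Fin (suc n)) t → InRegionAt π q (Fin.toℕ k) t → InX w q
  InRegionAt⇒InX q k t (It , y≡ , left≤x , x≤right) = k , t , It , y≡ ,
    subst (ℚ._≤ proj₁ q) (sym (left-boundary k t)) left≤x , subst (proj₁ q ℚ.≤_) (sym (right-boundary k t)) x≤right

  InRegion⇒InX : ∀ q → InRegion π q → InX w q
  InRegion⇒InX q (k , k<N , t , q∈) =
    InRegionAt⇒InX q (Fin.fromℕ< k<N) t (subst (λ k → InRegionAt π q k t) (sym (Fin.toℕ-fromℕ< k<N)) q∈)

  bottom≡bottomVertex : bottom (suc n) ≡ bottomVertex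
  bottom≡bottomVertex = trans (sumP-edges (suc n) (λ i → i))
    (cong (_, - ℕ→ℚ (suc n)) (prefixSum-cong (suc n) (λ p → extend-toℕ-identity)))

  StablePrefix⇒PrefixStable : ∀ r → r ≤ suc n → StablePrefix π r → PrefixStable w r
  StablePrefix⇒PrefixStable r r≤N stable j = image⊆ , ⊆image
    where
    image⊆ : (∃[ i ] (Fin.toℕ i < r × w ⟨$⟩ʳ i ≡ j)) → Fin.toℕ j < r
    image⊆ (i , i<r , wi≡j) = proj₁ (stable (Fin.toℕ j)) (Fin.toℕ i , i<r , trans (extend-toℕ _ i) (cong Fin.toℕ wi≡j))
    ⊆image : Fin.toℕ j < r → ∃[ i ] (Fin.toℕ i < r × w ⟨$⟩ʳ i ≡ j)
    ⊆image j<r with proj₂ (stable (Fin.toℕ j)) j<r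
    ... | p , p<r , πp≡j = Fin.fromℕ< p<N , subst (_< r) (sym (Fin.toℕ-fromℕ< p<N)) p<r ,
                           Fin.toℕ-injective (trans (sym (extend-fromℕ< _ p<N)) πp≡j)
      where
      p<N : p < suc n
      p<N = ℕ.<-≤-trans p<r r≤N

  πn≡ : π n ≡ Fin.toℕ (w ⟨$⟩ʳ fromℕ n)
  πn≡ = trans (cong π (sym (Fin.toℕ-fromℕ n))) (extend-toℕ _ (fromℕ n))

  top-perimeter : ∀ T → TileWithBase origin 0 (π 0) T → TopPerimeter w T
  top-perimeter T (base≡ , a≡0 , b≡w0) =
    subst₂ (λ P i → SegIn P (vec i) T) base≡ (Fin.toℕ-injective a≡0) (proj₁ (tile-sides-at-base T)) ,
    subst₂ (λ P i → SegIn P (vec i) T) base≡ (Fin.toℕ-injective b≡w0) (proj₂ (tile-sides-at-base T))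

  bottom-perimeter : ∀ T → Touches π (suc n) → TileWithFarCorner (prefixSum π (suc n)) (π n) n T → BottomPerimeter w T
  bottom-perimeter T touches (corner≡ , a≡πn , b≡n) =
    subst₂ (λ P i → SegIn (P ⊕ (-_ₚ (vec i))) (vec i) T) corner≡bottom
      (Fin.toℕ-injective (trans b≡n (sym (Fin.toℕ-fromℕ n)))) (proj₂ (tile-sides-at-farCorner T)) ,
    subst₂ (λ P i → SegIn (P ⊕ (-_ₚ (vec i))) (vec i) T) corner≡bottom (Fin.toℕ-injective (trans a≡πn πn≡))
      (proj₁ (tile-sides-at-farCorner T))
    where
    corner≡bottom : tileFarCorner T ≡ bottom (suc n)
    corner≡bottom = trans corner≡ (trans (cong (_, - ℕ→ℚ (suc n)) touches) (sym bottom≡bottomVertex))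

  module Irreducible (1<N : 1 < suc n) (irreducible : ∀ r → 1 ≤ r → r < suc n → ¬ PrefixStable w r) where

    module _ (c : Chain π) where

      untouched : ∀ r → 1 ≤ r → r < suc n → ¬ Touches π r
      untouched r 1≤r r<N touches = irreducible r 1≤r r<N
        (StablePrefix⇒PrefixStable r (ℕ.<⇒≤ r<N) (chain-touches⇒stable c r (ℕ.<⇒≤ r<N) touches))

      π-moves-0 : ¬ π 0 ≡ 0
      π-moves-0 π0≡0 = untouched 1 ℕ.≤-refl 1<N (cong (λ v → ℕ→ℚ v + 0ℚ) π0≡0)

      π-moves-n : ¬ π n ≡ n
      π-moves-n πn≡n = untouched n (ℕ.≤-pred 1<N) (ℕ.n<1+n n) (+-cancelʳ-≡ (begin
        prefixSum π n + ℕ→ℚ n            ≡⟨ cong (λ v → prefixSum π n + ℕ→ℚ v) (sym πn≡n) ⟩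
        prefixSum π n + ℕ→ℚ (π n)        ≡⟨ sym (prefixSum-suc π n) ⟩
        prefixSum π (suc n)              ≡⟨ chain-touches-N c ⟩
        prefixSum (λ p → p) (suc n)      ≡⟨ prefixSum-suc (λ p → p) n ⟩
        prefixSum (λ p → p) n + ℕ→ℚ n    ∎))
        where open ≡-Reasoning

      covered-region : ∀ q → InRegion π q → Covered (tiles c) q
      covered-region (x , y) (k , k<N , t , q∈) = by-width (left k t ℚ.<? right π k t)
        where
        by-corner : (x , y) ≡ origin ⊎ (x , y) ≡ bottomVertex → Covered (tiles c) (x , y)
        by-corner (inj₁ refl) = tiles-cover-origin c (ℕ.<-trans (ℕ.s≤s ℕ.z≤n) 1<N) π-moves-0
        by-corner (inj₂ refl) = tiles-cover-bottom c n refl π-moves-n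
        by-width : Dec (left k t ℚ.< right π k t) → Covered (tiles c) (x , y)
        by-width (yes left<right) = tiles-cover-wide c (x , y) (k , k<N , t , q∈ , left<right)
        by-width (no left≮right)  =
          by-corner (pinch⇒corner 1<N (chain-ordered c) untouched x y k t k<N q∈ (ℚ.≮⇒≥ left≮right))

      covered : ∀ q → InX w q → Covered (tiles c) q
      covered q q∈X = covered-region q (InX⇒InRegion q q∈X)

      tiling : IsRhombicTiling w (tiles c)
      tiling = (λ j q q∈T → InRegion⇒InX q (tiles⊆region c j q q∈T)) ,
               (λ q q∈X → Any.index (covered q q∈X) , lookup-index (covered q q∈X)) ,
               tiles-disjoint c

    top-tiling : ¬ (w ⟨$⟩ʳ zero ≡ zero) → ∃[ ts ] (IsRhombicTiling w ts × ∃[ i ] TopPerimeter w (lookup ts i))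
    top-tiling w0≢0 =
      from-chain (topChain (ℕ.<-trans (ℕ.s≤s ℕ.z≤n) 1<N) π-inverse (λ π0≡0 → w0≢0 (Fin.toℕ-injective π0≡0)))
      where
      from-chain : Σ (Chain π) (λ c → Any (TileWithBase origin 0 (π 0)) (tiles c)) →
                   ∃[ ts ] (IsRhombicTiling w ts × ∃[ i ] TopPerimeter w (lookup ts i))
      from-chain (c , top-tile) =
        tiles c , tiling c , Any.index top-tile , top-perimeter (lookup (tiles c) (Any.index top-tile)) (lookup-index top-tile)

    bottom-tiling : ¬ (w ⟨$⟩ʳ fromℕ n ≡ fromℕ n) →
                    ∃[ ts ] (IsRhombicTiling w ts × ∃[ i ] BottomPerimeter w (lookup ts i))
    bottom-tiling wn≢n = from-chain (bottomChain n refl π-inverse πn≢n)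
      where
      πn≢n : ¬ π n ≡ n
      πn≢n πn≡n = wn≢n (Fin.toℕ-injective (trans (sym πn≡) (trans πn≡n (sym (Fin.toℕ-fromℕ n)))))
      from-chain : Σ (Chain π) (λ c → Any (TileWithFarCorner (prefixSum π (suc n)) (π n) n) (tiles c)) →
                   ∃[ ts ] (IsRhombicTiling w ts × ∃[ i ] BottomPerimeter w (lookup ts i))
      from-chain (c , bottom-tile) =
        tiles c , tiling c , Any.index bottom-tile ,
        bottom-perimeter (lookup (tiles c) (Any.index bottom-tile)) (chain-touches-N c) (lookup-index bottom-tile)

lemma4p4 : (n : ℕ) → 1 < suc n → (w : Permutation′ (suc n)) →
    (∀ r → 1 ≤ r → r < suc n → ¬ PrefixStable w r) →
    (¬ (w ⟨$⟩ʳ zero ≡ zero) →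
    ∃[ ts ] (IsRhombicTiling w ts × ∃[ i ] TopPerimeter w (lookup ts i)))
    × (¬ (w ⟨$⟩ʳ fromℕ n ≡ fromℕ n) →
    ∃[ ts ] (IsRhombicTiling w ts × ∃[ i ] BottomPerimeter w (lookup ts i)))
lemma4p4 n 1<N w irreducible = top-tiling , bottom-tiling
  where open Elnitsky.Irreducible n w 1<N irreducible
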